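{- Let $m$, $n$ be non-negative integers and $r$ any integer. Then \[ \sum_{k = 1}^n k^m w_{k + r} = \mathcal P_1 (m,n;p,q)w_{n + r} + \mathcal P_2 (m,n;p,q)w_{n + r + 1} + \mathcal C(m,r;a,b,p,q), \] where \[ \mathcal P_1 (m,n;p,q)=\frac{n^mq}{1 - p + q} + q\sum_{s = 1}^m \binom ms\frac{n^{m - s} }{(1 - p + q )^{s + 1} }\sum_{c = 0}^{s + 1} ( - 1)^c \binom{s + 1}cq^{c} \sum_{j = 0}^s A(s,j)U_{j - c - 1}, \] \[ \mathcal P_2 (m,n;p,q)=-\frac{n^m}{1 - p + q} - \sum_{s = 1}^m \binom ms\frac{n^{m - s} }{(1 - p + q )^{s + 1} }\sum_{c = 0}^{s + 1} ( - 1)^c \binom{s + 1}cq^{c} \sum_{j = 0}^s A(s,j)U_{j - c}, \] \[ \mathcal C(m,r;a,b,p,q)=- w_r\delta _{m,0} + \frac1{(1 - p + q )^{m + 1} }\sum_{c = 0}^{m + 1} ( - 1)^c \binom{m + 1}cq^c \sum_{j = 0}^m A(m,j)w_{j - c + r}. \]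
   Context: Let $a,b,p,q$ be complex numbers with $p\ne0$, $q\ne0$ and $p\ne q+1$. The Horadam sequence $(w_j)=(w_j(a,b;p,q))$ is defined by $w_0=a$, $w_1=b$, $w_j=pw_{j-1}-qw_{j-2}$ for $j\ge2$, extended to negative indices by $w_{ -j}=(pw_{ -j+1}-w_{ -j+2})/q$. $(U_j)=(w_j(0,1;p,q))$ is the Lucas sequence of the first kind (also defined for negative indices). $\delta_{m,0}$ is the Kronecker delta. The Eulerian numbers are $A(i,j)=\sum_{t=0}^j(-1)^t\binom{i+1}{t}(j-t)^i$ for non-negative integers $i,j$, with $0^0=1$. Empty sums are $0$. -}

module Defs where

open import Level using (Level)
open import Data.Nat as ℕ using (ℕ; zero; suc)
open import Data.Nat.Combinatorics using (_C_)
open import Data.Integer as ℤ using (ℤ; +_; -[1+_])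
open import Data.Product using (_×_; _,_; proj₁)
open import Algebra.Bundles using (CommutativeRing)

-- Everything is developed over an arbitrary commutative ring R
-- (the paper works over ℂ).
module Horadam {c ℓ : Level} (R : CommutativeRing c ℓ) where
  open CommutativeRing R

  fromℕ : ℕ → Carrier
  fromℕ zero = 0#
  fromℕ (suc n) = 1# + fromℕ n

  pow : Carrier → ℕ → Carrier
  pow x zero = 1#
  pow x (suc n) = x * pow x n

  sgn : ℕ → Carrier
  sgn zero = 1#
  sgn (suc n) = - sgn n

  Σ< : ℕ → (ℕ → Carrier) → Carrier
  Σ< zero f = 0#
  Σ< (suc n) f = Σ< n f + f n

  δ0 : ℕ → Carrier
  δ0 zero = 1#
  δ0 (suc m) = 0#

  eulerA : ℕ → ℕ → Carrier
  eulerA i j = Σ< (suc j) (λ t → sgn t * (fromℕ ((suc i) C t) * fromℕ ((j ℕ.∸ t) ℕ.^ i)))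

  -- Horadam sequence w_j(a,b;p,q); qinv is the inverse of q (used for negative indices).
  -- forward n = (w_n , w_{n+1})
  forward : (a b p q : Carrier) → ℕ → Carrier × Carrier
  forward a b p q zero = a , b
  forward a b p q (suc n) with forward a b p q n
  ... | (x , y) = y , (p * y - q * x)

  -- backward n = (w_{-n} , w_{-n+1}),  w_{-j} = (p w_{-j+1} - w_{-j+2}) / q
  backward : (a b p q qinv : Carrier) → ℕ → Carrier × Carrier
  backward a b p q qinv zero = a , b
  backward a b p q qinv (suc n) with backward a b p q qinv n
  ... | (x , y) = ((p * x - y) * qinv) , x

  w : (a b p q qinv : Carrier) → ℤ → Carrier
  w a b p q qinv (+ n) = proj₁ (forward a b p q n)
  w a b p q qinv -[1+ n ] = proj₁ (backward a b p q qinv (suc n))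

  U : (p q qinv : Carrier) → ℤ → Carrier
  U p q qinv = w 0# 1# p q qinv

{-# OPTIONS --safe #-}
-- Write E for the shift of two-sided sequences ℤ → R, ∇ₐ = 1 − a E⁻¹ and Δ = 1 − E. On
-- solutions of f(z+1) = p f(z) − q f(z−1) we have E + q E⁻¹ = p, so Δ ∇_q = 1 − p + q and
-- Δ is inverted by L = (1 − p + q)⁻¹ ∇_q; in particular a solution killed by a power of Δ is 0.
-- The Eulerian numbers A(s,j) are the values of ∇₁^(s+1) applied to k ↦ kˢ (zero for k < 0);
-- they vanish for j > s because ∇₁^(s+1) annihilates polynomials of degree s.
-- Put H_t = Σ_s C(m,s) t^(m−s) L^(s+1) Σ_j A(s,j) Eʲ f. Then Δ^(m+1) H_t is f convolved with
-- ∇₁^(m+1) of z ↦ (z + t)^m (cut off below 0), and comparing t with t + 1 shows that Δ^(m+1) kills the solution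
-- H_t − E H_(t+1) − t^m f. Hence H_t(z) − H_(t+1)(z+1) = t^m f(z) and the sum telescopes; the
-- closed form follows by expanding L^(s+1) binomially and using w_(N+k) = U_k w_(N+1) − q U_(k−1) w_N.
module Submission where

open import Defs
open import Level using (Level; _⊔_)
open import Data.Nat as ℕ using (ℕ; zero; suc; _∸_; _^_; _≤_; _<_; s≤s)
open import Data.Nat.Combinatorics using (_C_; k>n⇒nCk≡0; nCn≡1; nCk+nC[k+1]≡[n+1]C[k+1])
import Data.Nat.Properties as ℕ
open import Data.Integer as ℤ using (ℤ; +_; -[1+_]; _⊖_; 1ℤ) renaming (_+_ to _+ℤ_; _-_ to _-ℤ_)
import Data.Integer.Properties as ℤ
open import Data.Integer.Solver using () renaming (module +-*-Solver to ℤ-Solver)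
import Data.Sign as Sign
open import Data.Sum using (inj₁; inj₂)
import Data.Fin as Fin
open import Data.Maybe using (Maybe; just; nothing)
open import Data.Product using (_×_; _,_; proj₁)
open import Relation.Nullary using (¬_; yes; no)
open import Relation.Binary.PropositionalEquality as ≡ using (_≡_)
open import Algebra.Bundles using (CommutativeRing; Semiring)
import Algebra.Solver.Ring.AlmostCommutativeRing as ACR

[m∸s]+[1+s]≡1+m : ∀ {m s} → s ≤ m → (m ∸ s) ℕ.+ suc s ≡ suc m
[m∸s]+[1+s]≡1+m {m} {s} s≤m = ≡.trans (ℕ.+-suc (m ∸ s) s) (≡.cong suc (ℕ.m∸n+n≡m s≤m))

[N-i]+j≡[j-i]+N : ∀ N i j → (N ℤ.- i) ℤ.+ j ≡ j ℤ.- i ℤ.+ N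
[N-i]+j≡[j-i]+N = solve 3 (λ N i j → (N :- i) :+ j := j :- i :+ N) ≡.refl
  where open ℤ-Solver

0^[m∸s]≡0 : ∀ {m s} → s < m → 0 ^ (m ∸ s) ≡ 0
0^[m∸s]≡0 {suc m} {zero}  _         = ≡.refl
0^[m∸s]≡0 {suc m} {suc s} (s≤s s<m) = 0^[m∸s]≡0 s<m

module _ {c ℓ : Level} (R : CommutativeRing c ℓ) where
  open CommutativeRing R hiding (zero)
  open Horadam R
  open import Relation.Binary.Reasoning.Setoid setoid
  open import Algebra.Properties.Ring ring using (-‿involutive; -‿distribˡ-*; -0#≈0#; -‿anti-homo-+)
  open import Algebra.Properties.CommutativeSemiring.Binomial commutativeSemiring as Binomial using ()
  open import Algebra.Definitions.RawMonoid +-rawMonoid as Sum using () renaming (_×_ to _×′_)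
  open import Algebra.Definitions.RawSemiring (Semiring.rawSemiring semiring) as Exp using ()

  fromℕ-+ : ∀ m n → fromℕ (m ℕ.+ n) ≈ fromℕ m + fromℕ n
  fromℕ-+ zero    n = sym (+-identityˡ _)
  fromℕ-+ (suc m) n = trans (+-congˡ (fromℕ-+ m n)) (sym (+-assoc _ _ _))

  fromℕ-* : ∀ m n → fromℕ (m ℕ.* n) ≈ fromℕ m * fromℕ n
  fromℕ-* zero    n = sym (zeroˡ _)
  fromℕ-* (suc m) n = begin
    fromℕ (n ℕ.+ m ℕ.* n)             ≈⟨ fromℕ-+ n (m ℕ.* n) ⟩
    fromℕ n + fromℕ (m ℕ.* n)         ≈⟨ +-cong (sym (*-identityˡ _)) (fromℕ-* m n) ⟩
    1# * fromℕ n + fromℕ m * fromℕ n  ≈⟨ distribʳ _ _ _ ⟨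
    (1# + fromℕ m) * fromℕ n          ∎

  fromℕ-∸ : ∀ m n → n ≤ m → fromℕ (m ∸ n) ≈ fromℕ m - fromℕ n
  fromℕ-∸ m n n≤m = begin
    fromℕ (m ∸ n)                        ≈⟨ +-identityʳ _ ⟨
    fromℕ (m ∸ n) + 0#                   ≈⟨ +-congˡ (-‿inverseʳ (fromℕ n)) ⟨
    fromℕ (m ∸ n) + (fromℕ n - fromℕ n)  ≈⟨ +-assoc _ _ _ ⟨
    fromℕ (m ∸ n) + fromℕ n - fromℕ n    ≈⟨ +-congʳ (fromℕ-+ (m ∸ n) n) ⟨
    fromℕ (m ∸ n ℕ.+ n) - fromℕ n        ≡⟨ ≡.cong (λ k → fromℕ k - fromℕ n) (ℕ.m∸n+n≡m n≤m) ⟩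
    fromℕ m - fromℕ n                    ∎

  pow-cong : ∀ {x y} n → x ≈ y → pow x n ≈ pow y n
  pow-cong zero    x≈y = refl
  pow-cong (suc n) x≈y = *-cong x≈y (pow-cong n x≈y)

  pow-1# : ∀ n → pow 1# n ≈ 1#
  pow-1# zero    = refl
  pow-1# (suc n) = trans (*-identityˡ _) (pow-1# n)

  fromℕ-^ : ∀ n s → fromℕ (n ^ s) ≈ pow (fromℕ n) s
  fromℕ-^ n zero    = +-identityʳ _
  fromℕ-^ n (suc s) = trans (fromℕ-* n (n ^ s)) (*-congˡ (fromℕ-^ n s))

  fromℕ-0^≈δ0 : ∀ m → fromℕ (0 ^ m) ≈ δ0 m
  fromℕ-0^≈δ0 zero    = +-identityʳ _
  fromℕ-0^≈δ0 (suc m) = refl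

  fromℤ : ℤ → Carrier
  fromℤ (+ n)    = fromℕ n
  fromℤ -[1+ n ] = - fromℕ (suc n)

  fromℤ-⊖ : ∀ m n → fromℤ (m ⊖ n) ≈ fromℕ m - fromℕ n
  fromℤ-⊖ m n with ℕ.≤-<-connex n m
  ... | inj₁ n≤m = trans (reflexive (≡.cong fromℤ (ℤ.⊖-≥ n≤m))) (fromℕ-∸ m n n≤m)
  ... | inj₂ m<n = begin
    fromℤ (m ⊖ n)              ≡⟨ ≡.cong fromℤ (ℤ.⊖-< m<n) ⟩
    fromℤ (ℤ.- (+ (n ∸ m)))    ≈⟨ fromℤ-neg⁺ (n ∸ m) ⟩
    - fromℕ (n ∸ m)            ≈⟨ -‿cong (fromℕ-∸ n m (ℕ.<⇒≤ m<n)) ⟩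
    - (fromℕ n - fromℕ m)      ≈⟨ -‿anti-homo-+ _ _ ⟩
    - - fromℕ m - fromℕ n      ≈⟨ +-congʳ (-‿involutive _) ⟩
    fromℕ m - fromℕ n          ∎
    where
    fromℤ-neg⁺ : ∀ k → fromℤ (ℤ.- (+ k)) ≈ - fromℕ k
    fromℤ-neg⁺ zero    = sym -0#≈0#
    fromℤ-neg⁺ (suc k) = refl

  fromℤ-neg : ∀ i → fromℤ (ℤ.- i) ≈ - fromℤ i
  fromℤ-neg (+ zero)  = sym -0#≈0#
  fromℤ-neg (+ suc n) = refl
  fromℤ-neg -[1+ n ]  = sym (-‿involutive _)

  fromℤ-+ : ∀ i j → fromℤ (i ℤ.+ j) ≈ fromℤ i + fromℤ j
  fromℤ-+ (+ m)    (+ n)    = fromℕ-+ m n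
  fromℤ-+ (+ m)    -[1+ n ] = fromℤ-⊖ m (suc n)
  fromℤ-+ -[1+ m ] (+ n)    = trans (fromℤ-⊖ n (suc m)) (+-comm _ _)
  fromℤ-+ -[1+ m ] -[1+ n ] = begin
    - (1# + (1# + fromℕ (m ℕ.+ n)))        ≈⟨ -‿cong (+-congˡ (+-congˡ (fromℕ-+ m n))) ⟩
    - (1# + (1# + (fromℕ m + fromℕ n)))    ≈⟨ -‿cong (+-congˡ (+-comm _ _)) ⟩
    - (1# + ((fromℕ m + fromℕ n) + 1#))    ≈⟨ -‿cong (+-congˡ (+-assoc _ _ _)) ⟩
    - (1# + (fromℕ m + (fromℕ n + 1#)))    ≈⟨ -‿cong (+-assoc _ _ _) ⟨
    - ((1# + fromℕ m) + (fromℕ n + 1#))    ≈⟨ -‿cong (+-congˡ (+-comm _ _)) ⟩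
    - ((1# + fromℕ m) + (1# + fromℕ n))    ≈⟨ -‿anti-homo-+ _ _ ⟩
    - (1# + fromℕ n) - (1# + fromℕ m)      ≈⟨ +-comm _ _ ⟩
    - (1# + fromℕ m) - (1# + fromℕ n)      ∎

  signᴿ : Sign.Sign → Carrier
  signᴿ Sign.+ = 1#
  signᴿ Sign.- = - 1#

  signᴿ-* : ∀ s t → signᴿ (s Sign.* t) ≈ signᴿ s * signᴿ t
  signᴿ-* Sign.- Sign.- = begin
    1#             ≈⟨ -‿involutive 1# ⟨
    - - 1#         ≈⟨ -‿cong (*-identityˡ _) ⟨
    - (1# * - 1#)  ≈⟨ -‿distribˡ-* _ _ ⟩
    - 1# * - 1#    ∎
  signᴿ-* Sign.- Sign.+ = sym (*-identityʳ _)
  signᴿ-* Sign.+ _      = sym (*-identityˡ _)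

  fromℤ-◃ : ∀ s n → fromℤ (s ℤ.◃ n) ≈ signᴿ s * fromℕ n
  fromℤ-◃ s      zero    = sym (zeroʳ _)
  fromℤ-◃ Sign.- (suc n) = trans (-‿cong (sym (*-identityˡ _))) (-‿distribˡ-* _ _)
  fromℤ-◃ Sign.+ (suc n) = sym (*-identityˡ _)

  fromℤ-* : ∀ i j → fromℤ (i ℤ.* j) ≈ fromℤ i * fromℤ j
  fromℤ-* i j = begin
    fromℤ (i ℤ.* j)                                ≈⟨ fromℤ-◃ (sᵢ Sign.* sⱼ) (∣i∣ ℕ.* ∣j∣) ⟩
    signᴿ (sᵢ Sign.* sⱼ) * fromℕ (∣i∣ ℕ.* ∣j∣)     ≈⟨ *-cong (signᴿ-* sᵢ sⱼ) (fromℕ-* ∣i∣ ∣j∣) ⟩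
    (signᴿ sᵢ * signᴿ sⱼ) * (fromℕ ∣i∣ * fromℕ ∣j∣) ≈⟨ interchange _ _ _ _ ⟩
    (signᴿ sᵢ * fromℕ ∣i∣) * (signᴿ sⱼ * fromℕ ∣j∣) ≈⟨ *-cong (fromℤ-sign i) (fromℤ-sign j) ⟨
    fromℤ i * fromℤ j                              ∎
    where
    sᵢ = ℤ.sign i ; sⱼ = ℤ.sign j ; ∣i∣ = ℤ.∣ i ∣ ; ∣j∣ = ℤ.∣ j ∣
    fromℤ-sign : ∀ k → fromℤ k ≈ signᴿ (ℤ.sign k) * fromℕ ℤ.∣ k ∣
    fromℤ-sign k = trans (reflexive (≡.cong fromℤ (≡.sym (ℤ.◃-inverse k)))) (fromℤ-◃ (ℤ.sign k) ℤ.∣ k ∣)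
    interchange : ∀ a b x y → (a * b) * (x * y) ≈ (a * x) * (b * y)
    interchange a b x y = begin
      (a * b) * (x * y)  ≈⟨ *-assoc _ _ _ ⟩
      a * (b * (x * y))  ≈⟨ *-congˡ (*-assoc _ _ _) ⟨
      a * ((b * x) * y)  ≈⟨ *-congˡ (*-congʳ (*-comm b x)) ⟩
      a * ((x * b) * y)  ≈⟨ *-congˡ (*-assoc _ _ _) ⟩
      a * (x * (b * y))  ≈⟨ *-assoc _ _ _ ⟨
      (a * x) * (b * y)  ∎

  -- Agrees with fromℤ, but sends + 1 to 1# on the nose, so that the solver's constant
  -- con 1ℤ is literally 1# in the goals it is used on.
  ⟦_⟧ : ℤ → Carrier
  ⟦ + 1 ⟧ = 1#
  ⟦ i   ⟧ = fromℤ i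

  ⟦⟧≈fromℤ : ∀ i → ⟦ i ⟧ ≈ fromℤ i
  ⟦⟧≈fromℤ (+ zero)        = refl
  ⟦⟧≈fromℤ (+ 1)           = sym (+-identityʳ _)
  ⟦⟧≈fromℤ (+ suc (suc n)) = refl
  ⟦⟧≈fromℤ -[1+ n ]        = refl

  ℤ⟶R : ℤ.+-*-rawRing ACR.-Raw-AlmostCommutative⟶ ACR.fromCommutativeRing R
  ℤ⟶R = record
    { ⟦_⟧    = ⟦_⟧
    ; +-homo = λ i j → trans (⟦⟧≈fromℤ (i ℤ.+ j)) (trans (fromℤ-+ i j) (sym (+-cong (⟦⟧≈fromℤ i) (⟦⟧≈fromℤ j))))
    ; *-homo = λ i j → trans (⟦⟧≈fromℤ (i ℤ.* j)) (trans (fromℤ-* i j) (sym (*-cong (⟦⟧≈fromℤ i) (⟦⟧≈fromℤ j))))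
    ; -‿homo = λ i → trans (⟦⟧≈fromℤ (ℤ.- i)) (trans (fromℤ-neg i) (sym (-‿cong (⟦⟧≈fromℤ i))))
    ; 0-homo = refl
    ; 1-homo = refl
    }

  ⟦⟧-weaklyDecidable : ∀ i j → Maybe (⟦ i ⟧ ≈ ⟦ j ⟧)
  ⟦⟧-weaklyDecidable i j with i ℤ.≟ j
  ... | yes ≡.refl = just refl
  ... | no _       = nothing

  open import Algebra.Solver.Ring ℤ.+-*-rawRing (ACR.fromCommutativeRing R) ℤ⟶R ⟦⟧-weaklyDecidable
    using (solve; _:=_; _:+_; _:*_; _:-_; :-_; con)

  Σ-cong : ∀ n {f g : ℕ → Carrier} → (∀ i → f i ≈ g i) → Σ< n f ≈ Σ< n g
  Σ-cong zero    f≈g = refl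
  Σ-cong (suc n) f≈g = +-cong (Σ-cong n f≈g) (f≈g n)

  Σ-cong< : ∀ n {f g : ℕ → Carrier} → (∀ i → i < n → f i ≈ g i) → Σ< n f ≈ Σ< n g
  Σ-cong< zero    f≈g = refl
  Σ-cong< (suc n) f≈g = +-cong (Σ-cong< n (λ i i<n → f≈g i (ℕ.m<n⇒m<1+n i<n))) (f≈g n ℕ.≤-refl)

  Σ-zero< : ∀ n {f : ℕ → Carrier} → (∀ i → i < n → f i ≈ 0#) → Σ< n f ≈ 0#
  Σ-zero< zero    f≈0 = refl
  Σ-zero< (suc n) f≈0 = trans (+-cong (Σ-zero< n (λ i i<n → f≈0 i (ℕ.m<n⇒m<1+n i<n))) (f≈0 n ℕ.≤-refl)) (+-identityˡ _)

  Σ-zero : ∀ n {f : ℕ → Carrier} → (∀ i → f i ≈ 0#) → Σ< n f ≈ 0#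
  Σ-zero n f≈0 = Σ-zero< n (λ i _ → f≈0 i)

  Σ-+ : ∀ n (f g : ℕ → Carrier) → Σ< n (λ i → f i + g i) ≈ Σ< n f + Σ< n g
  Σ-+ zero    f g = sym (+-identityˡ _)
  Σ-+ (suc n) f g = trans (+-congʳ (Σ-+ n f g))
    (solve 4 (λ a b x y → (a :+ b) :+ (x :+ y) := (a :+ x) :+ (b :+ y)) refl _ _ _ _)

  Σ-neg : ∀ n (f : ℕ → Carrier) → Σ< n (λ i → - f i) ≈ - Σ< n f
  Σ-neg zero    f = sym -0#≈0#
  Σ-neg (suc n) f = trans (+-congʳ (Σ-neg n f)) (solve 2 (λ a b → (:- a) :+ (:- b) := :- (a :+ b)) refl _ _)

  Σ-sub : ∀ n (f g : ℕ → Carrier) → Σ< n (λ i → f i - g i) ≈ Σ< n f - Σ< n g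
  Σ-sub n f g = trans (Σ-+ n f (λ i → - g i)) (+-congˡ (Σ-neg n g))

  Σ-*ˡ : ∀ n a (f : ℕ → Carrier) → Σ< n (λ i → a * f i) ≈ a * Σ< n f
  Σ-*ˡ zero    a f = sym (zeroʳ _)
  Σ-*ˡ (suc n) a f = trans (+-congʳ (Σ-*ˡ n a f)) (sym (distribˡ _ _ _))

  Σ-*ʳ : ∀ n a (f : ℕ → Carrier) → Σ< n (λ i → f i * a) ≈ Σ< n f * a
  Σ-*ʳ n a f = trans (Σ-cong n (λ i → *-comm _ _)) (trans (Σ-*ˡ n a f) (*-comm _ _))

  Σ-lincomb : ∀ n (a g h : ℕ → Carrier) α β →
    Σ< n (λ i → a i * (α * g i + β * h i)) ≈ α * Σ< n (λ i → a i * g i) + β * Σ< n (λ i → a i * h i)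
  Σ-lincomb zero    a g h α β = solve 2 (λ α β → con (+ 0) := α :* con (+ 0) :+ β :* con (+ 0)) refl α β
  Σ-lincomb (suc n) a g h α β = trans (+-congʳ (Σ-lincomb n a g h α β))
    (solve 7 (λ α β x y a g h → α :* x :+ β :* y :+ a :* (α :* g :+ β :* h) := α :* (x :+ a :* g) :+ β :* (y :+ a :* h)) refl α β _ _ (a n) (g n) (h n))

  Σ-head : ∀ n (f : ℕ → Carrier) → Σ< (suc n) f ≈ f 0 + Σ< n (λ i → f (suc i))
  Σ-head zero    f = +-comm _ _
  Σ-head (suc n) f = trans (+-congʳ (Σ-head n f)) (+-assoc _ _ _)

  Σ-comm : ∀ n k (f : ℕ → ℕ → Carrier) →
    Σ< n (λ i → Σ< k (λ j → f i j)) ≈ Σ< k (λ j → Σ< n (λ i → f i j))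
  Σ-comm zero    k f = sym (Σ-zero k (λ _ → refl))
  Σ-comm (suc n) k f = trans (+-congʳ (Σ-comm n k f)) (sym (Σ-+ k _ _))

  Σ-extend : ∀ {n m} (f : ℕ → Carrier) → n ≤ m → (∀ i → n ≤ i → f i ≈ 0#) → Σ< m f ≈ Σ< n f
  Σ-extend f n≤m = go (ℕ.≤⇒≤′ n≤m)
    where
    go : ∀ {n m} → n ℕ.≤′ m → (∀ i → n ≤ i → f i ≈ 0#) → Σ< m f ≈ Σ< n f
    go (ℕ.≤′-reflexive ≡.refl) f≈0 = refl
    go (ℕ.≤′-step n≤′m)        f≈0 = trans (+-cong (go n≤′m f≈0) (f≈0 _ (ℕ.≤′⇒≤ n≤′m))) (+-identityʳ _)

  Σ-telescope : ∀ n (u : ℕ → Carrier) → Σ< n (λ k → u k - u (suc k)) ≈ u 0 - u n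
  Σ-telescope zero    u = sym (-‿inverseʳ _)
  Σ-telescope (suc n) u = trans (+-congʳ (Σ-telescope n u))
    (solve 3 (λ x y z → (x :- y) :+ (y :- z) := x :- z) refl (u 0) (u n) (u (suc n)))

  private
    sum≈Σ : ∀ n (g : ℕ → Carrier) → Sum.sum {n} (λ i → g (Fin.toℕ i)) ≈ Σ< n g
    sum≈Σ zero    g = refl
    sum≈Σ (suc n) g = trans (+-congˡ (sum≈Σ n (λ i → g (suc i)))) (sym (Σ-head n g))

    ×≈fromℕ* : ∀ n a → n ×′ a ≈ fromℕ n * a
    ×≈fromℕ* zero    a = sym (zeroˡ _)
    ×≈fromℕ* (suc n) a = trans (+-cong (sym (*-identityˡ a)) (×≈fromℕ* n a)) (sym (distribʳ _ _ _))

    ^≈pow : ∀ x n → x Exp.^ n ≈ pow x n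
    ^≈pow x zero    = refl
    ^≈pow x (suc n) = *-congˡ (^≈pow x n)

  fromℕ-binomial : ∀ n t m → fromℕ ((n ℕ.+ t) ^ m) ≈ Σ< (suc m) (λ s → fromℕ (m C s) * fromℕ (t ^ (m ∸ s)) * fromℕ (n ^ s))
  fromℕ-binomial n t m = begin
    fromℕ ((n ℕ.+ t) ^ m)                       ≈⟨ fromℕ-^ (n ℕ.+ t) m ⟩
    pow (fromℕ (n ℕ.+ t)) m                     ≈⟨ pow-cong m (fromℕ-+ n t) ⟩
    pow (fromℕ n + fromℕ t) m                   ≈⟨ ^≈pow _ m ⟨
    (fromℕ n + fromℕ t) Exp.^ m                 ≈⟨ Binomial.theorem m (fromℕ n) (fromℕ t) ⟩
    Sum.sum {suc m} (λ i → term (Fin.toℕ i))    ≈⟨ sum≈Σ (suc m) term ⟩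
    Σ< (suc m) term                             ≈⟨ Σ-cong (suc m) term≈ ⟩
    Σ< (suc m) (λ s → fromℕ (m C s) * fromℕ (t ^ (m ∸ s)) * fromℕ (n ^ s)) ∎
    where
    term : ℕ → Carrier
    term s = (m C s) ×′ (fromℕ n Exp.^ s * fromℕ t Exp.^ (m ∸ s))
    term≈ : ∀ s → term s ≈ fromℕ (m C s) * fromℕ (t ^ (m ∸ s)) * fromℕ (n ^ s)
    term≈ s = begin
      term s                                                         ≈⟨ ×≈fromℕ* (m C s) _ ⟩
      fromℕ (m C s) * (fromℕ n Exp.^ s * fromℕ t Exp.^ (m ∸ s))
        ≈⟨ *-congˡ (*-cong (trans (^≈pow _ s) (sym (fromℕ-^ n s))) (trans (^≈pow _ (m ∸ s)) (sym (fromℕ-^ t (m ∸ s))))) ⟩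
      fromℕ (m C s) * (fromℕ (n ^ s) * fromℕ (t ^ (m ∸ s)))          ≈⟨ solve 3 (λ a b c → a :* (b :* c) := a :* c :* b) refl _ _ _ ⟩
      fromℕ (m C s) * fromℕ (t ^ (m ∸ s)) * fromℕ (n ^ s)            ∎

  -- Two-sided sequences and shift-invariant linear operators

  Seq : Set c
  Seq = ℤ → Carrier

  infix 4 _≋_
  _≋_ : Seq → Seq → Set ℓ
  f ≋ g = ∀ z → f z ≈ g z

  reindex : ∀ (h : Seq) {i j} → i ≡ j → h i ≈ h j
  reindex h i≡j = reflexive (≡.cong h i≡j)

  iter : (Seq → Seq) → ℕ → Seq → Seq
  iter F zero    h = h
  iter F (suc k) h = F (iter F k h)

  iter-suc : ∀ F k h → iter F k (F h) ≡ F (iter F k h)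
  iter-suc F zero    h = ≡.refl
  iter-suc F (suc k) h = ≡.cong F (iter-suc F k h)

  iter-+ : ∀ F a b h → iter F (a ℕ.+ b) h ≡ iter F a (iter F b h)
  iter-+ F zero    b h = ≡.refl
  iter-+ F (suc a) b h = ≡.cong F (iter-+ F a b h)

  record ShiftInvariantLinear (F : Seq → Seq) : Set (c ⊔ ℓ) where
    field
      ≋-cong     : ∀ {f g} → f ≋ g → F f ≋ F g
      +-hom      : ∀ f g → F (λ z → f z + g z) ≋ (λ z → F f z + F g z)
      *-hom      : ∀ a f → F (λ z → a * f z) ≋ (λ z → a * F f z)
      shift-comm : ∀ k f → F (λ z → f (z ℤ.+ k)) ≋ (λ z → F f (z ℤ.+ k))

    0-hom : F (λ _ → 0#) ≋ (λ _ → 0#)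
    0-hom z = begin
      F (λ _ → 0#) z       ≈⟨ ≋-cong (λ _ → sym (zeroˡ 0#)) z ⟩
      F (λ _ → 0# * 0#) z  ≈⟨ *-hom 0# (λ _ → 0#) z ⟩
      0# * F (λ _ → 0#) z  ≈⟨ zeroˡ _ ⟩
      0#                   ∎

    neg-hom : ∀ f → F (λ z → - f z) ≋ (λ z → - F f z)
    neg-hom f z = begin
      F (λ z → - f z) z         ≈⟨ ≋-cong (λ z → solve 1 (λ x → :- x := (:- con ℤ.1ℤ) :* x) refl (f z)) z ⟩
      F (λ z → - 1# * f z) z    ≈⟨ *-hom (- 1#) f z ⟩
      - 1# * F f z              ≈⟨ solve 1 (λ x → (:- con ℤ.1ℤ) :* x := :- x) refl _ ⟩
      - F f z                   ∎

    sub-hom : ∀ f g → F (λ z → f z - g z) ≋ (λ z → F f z - F g z)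
    sub-hom f g z = trans (+-hom f (λ z → - g z) z) (+-congˡ (neg-hom g z))

    Σ-hom : ∀ n (a : ℕ → Carrier) (G : ℕ → Seq) →
      F (λ z → Σ< n (λ i → a i * G i z)) ≋ (λ z → Σ< n (λ i → a i * F (G i) z))
    Σ-hom zero    a G = 0-hom
    Σ-hom (suc n) a G z = trans (+-hom _ _ z) (+-cong (Σ-hom n a G z) (*-hom (a n) (G n) z))

  open ShiftInvariantLinear

  iter-linear : ∀ {F} → ShiftInvariantLinear F → ∀ k → ShiftInvariantLinear (iter F k)
  iter-linear lF zero = record
    { ≋-cong = λ f≋g → f≋g ; +-hom = λ _ _ _ → refl ; *-hom = λ _ _ _ → refl ; shift-comm = λ _ _ _ → refl }
  iter-linear lF (suc k) = record
    { ≋-cong     = λ f≋g → ≋-cong lF (≋-cong lFᵏ f≋g)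
    ; +-hom      = λ f g z → trans (≋-cong lF (+-hom lFᵏ f g) z) (+-hom lF _ _ z)
    ; *-hom      = λ a f z → trans (≋-cong lF (*-hom lFᵏ a f) z) (*-hom lF a _ z)
    ; shift-comm = λ j f z → trans (≋-cong lF (shift-comm lFᵏ j f) z) (shift-comm lF j _ z)
    }
    where lFᵏ = iter-linear lF k

  iter-scaled : ∀ {F} → ShiftInvariantLinear F → ∀ d k g → iter (λ h z → d * F h z) k g ≋ (λ z → pow d k * iter F k g z)
  iter-scaled lF d zero    g z = sym (*-identityˡ _)
  iter-scaled {F} lF d (suc k) g z = begin
    d * F (iter dF k g) z                 ≈⟨ *-congˡ (≋-cong lF (iter-scaled lF d k g) z) ⟩
    d * F (λ y → pow d k * iter F k g y) z ≈⟨ *-congˡ (*-hom lF _ _ z) ⟩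
    d * (pow d k * iter F (suc k) g z)    ≈⟨ *-assoc _ _ _ ⟨
    pow d (suc k) * iter F (suc k) g z    ∎
    where dF = λ h z → d * F h z

  ∇ : Carrier → Seq → Seq
  ∇ a h z = h z - a * h (ℤ.pred z)

  Δ : Seq → Seq
  Δ h z = h z - h (ℤ.suc z)

  ∇-linear : ∀ a → ShiftInvariantLinear (∇ a)
  ∇-linear a = record
    { ≋-cong     = λ f≋g z → +-cong (f≋g z) (-‿cong (*-congˡ (f≋g _)))
    ; +-hom      = λ f g z → solve 5 (λ a x y u v → (x :+ y) :- a :* (u :+ v) := (x :- a :* u) :+ (y :- a :* v)) refl a _ _ _ _
    ; *-hom      = λ b f z → solve 4 (λ a b x u → b :* x :- a :* (b :* u) := b :* (x :- a :* u)) refl a b _ _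
    ; shift-comm = λ k f z → +-congˡ (-‿cong (*-congˡ (reindex f (ℤ.pred-+ z k))))
    }

  Δ-linear : ShiftInvariantLinear Δ
  Δ-linear = record
    { ≋-cong     = λ f≋g z → +-cong (f≋g z) (-‿cong (f≋g _))
    ; +-hom      = λ f g z → solve 4 (λ a b x y → (a :+ b) :- (x :+ y) := (a :- x) :+ (b :- y)) refl _ _ _ _
    ; *-hom      = λ a f z → solve 3 (λ a x y → a :* x :- a :* y := a :* (x :- y)) refl a _ _
    ; shift-comm = λ k f z → +-congˡ (-‿cong (reindex f (ℤ.+-assoc ℤ.1ℤ z k)))
    }

  binomialTerm : Carrier → ℕ → Seq → ℤ → ℕ → Carrier
  binomialTerm a k h z i = sgn i * fromℕ (k C i) * pow a i * h (z ℤ.- + i)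

  binomialTerm-pascal : ∀ a k h z i →
    binomialTerm a k h z (suc i) - a * binomialTerm a k h (ℤ.pred z) i ≈ binomialTerm a (suc k) h z (suc i)
  binomialTerm-pascal a k h z i = begin
    - s * fromℕ (k C suc i) * (a * pow a i) * h (z ℤ.- + suc i) - a * (s * fromℕ (k C i) * pow a i * h (ℤ.pred z ℤ.- + i))
      ≈⟨ +-congˡ (-‿cong (*-congˡ (*-congˡ (reindex h z-[1+i]≡pred[z]-i)))) ⟨
    - s * fromℕ (k C suc i) * (a * pow a i) * hᵢ - a * (s * fromℕ (k C i) * pow a i * hᵢ)
      ≈⟨ solve 6 (λ s x y a p u → (:- s) :* y :* (a :* p) :* u :- a :* (s :* x :* p :* u) := (:- s) :* (x :+ y) :* (a :* p) :* u) refl _ _ _ _ _ _ ⟩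
    - s * (fromℕ (k C i) + fromℕ (k C suc i)) * (a * pow a i) * hᵢ
      ≈⟨ *-congʳ (*-congʳ (*-congˡ (trans (sym (fromℕ-+ (k C i) (k C suc i))) (reflexive (≡.cong fromℕ (nCk+nC[k+1]≡[n+1]C[k+1] k i)))))) ⟩
    - s * fromℕ (suc k C suc i) * (a * pow a i) * hᵢ ∎
    where
    s = sgn i
    hᵢ = h (z ℤ.- + suc i)
    z-[1+i]≡pred[z]-i : z ℤ.- + suc i ≡ ℤ.pred z ℤ.- + i
    z-[1+i]≡pred[z]-i = ≡.trans (ℤ.minus-suc z i) (≡.sym (ℤ.pred-+ z (ℤ.- + i)))

  ∇-iter-binomial : ∀ a k h z → iter (∇ a) k h z ≈ Σ< (suc k) (binomialTerm a k h z)
  ∇-iter-binomial a zero h z = begin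
    h z                               ≈⟨ reindex h (ℤ.+-identityʳ z) ⟨
    h (z ℤ.+ + 0)                     ≈⟨ *-identityˡ _ ⟨
    1# * h (z ℤ.+ + 0)                ≈⟨ *-congʳ (trans (*-identityʳ _) (trans (*-identityˡ _) (+-identityʳ _))) ⟨
    binomialTerm a zero h z 0         ≈⟨ +-identityˡ _ ⟨
    Σ< 1 (binomialTerm a zero h z)    ∎
  ∇-iter-binomial a (suc k) h z = begin
    iter (∇ a) k h z - a * iter (∇ a) k h (ℤ.pred z)
      ≈⟨ +-cong (∇-iter-binomial a k h z) (-‿cong (*-congˡ (∇-iter-binomial a k h (ℤ.pred z)))) ⟩
    Σ< (suc k) (T k z) - a * Σ< (suc k) (T k (ℤ.pred z))
      ≈⟨ +-cong (sym (+-identityʳ _)) (-‿cong (sym (Σ-*ˡ (suc k) a _))) ⟩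
    (Σ< (suc k) (T k z) + 0#) - Σ< (suc k) (λ i → a * T k (ℤ.pred z) i)
      ≈⟨ +-congʳ (+-congˡ last≈0) ⟨
    Σ< (suc (suc k)) (T k z) - Σ< (suc k) (λ i → a * T k (ℤ.pred z) i)
      ≈⟨ +-congʳ (Σ-head (suc k) (T k z)) ⟩
    (T k z 0 + Σ< (suc k) (λ i → T k z (suc i))) - Σ< (suc k) (λ i → a * T k (ℤ.pred z) i)
      ≈⟨ +-assoc _ _ _ ⟩
    T k z 0 + (Σ< (suc k) (λ i → T k z (suc i)) - Σ< (suc k) (λ i → a * T k (ℤ.pred z) i))
      ≈⟨ +-congˡ (Σ-sub (suc k) _ _) ⟨
    T k z 0 + Σ< (suc k) (λ i → T k z (suc i) - a * T k (ℤ.pred z) i)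
      ≈⟨ +-congˡ (Σ-cong (suc k) (binomialTerm-pascal a k h z)) ⟩
    T (suc k) z 0 + Σ< (suc k) (λ i → T (suc k) z (suc i))
      ≈⟨ Σ-head (suc k) (T (suc k) z) ⟨
    Σ< (suc (suc k)) (T (suc k) z) ∎
    where
    T = λ k z → binomialTerm a k h z
    last≈0 : T k z (suc k) ≈ 0#
    last≈0 = begin
      sgn (suc k) * fromℕ (k C suc k) * pow a (suc k) * h (z ℤ.- + suc k)
        ≡⟨ ≡.cong (λ n → sgn (suc k) * fromℕ n * pow a (suc k) * h (z ℤ.- + suc k)) (k>n⇒nCk≡0 (ℕ.n<1+n k)) ⟩
      sgn (suc k) * 0# * pow a (suc k) * h (z ℤ.- + suc k)
        ≈⟨ trans (*-congʳ (trans (*-congʳ (zeroʳ _)) (zeroˡ _))) (zeroˡ _) ⟩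
      0# ∎

  convolve : ℕ → Seq → Seq → Seq
  convolve B c h z = Σ< B (λ j → c (+ j) * h (z ℤ.+ + j))

  VanishesFrom : Seq → ℕ → Set ℓ
  VanishesFrom c B = ∀ j → B ≤ j → c (+ j) ≈ 0#

  Causal : Seq → Set ℓ
  Causal c = ∀ n → c -[1+ n ] ≈ 0#

  impulse : Seq
  impulse (+ zero)  = 1#
  impulse (+ suc n) = 0#
  impulse -[1+ n ]  = 0#

  impulse-vanishesFrom : VanishesFrom impulse 1
  impulse-vanishesFrom (suc j) _ = refl

  impulse-causal : Causal impulse
  impulse-causal n = refl

  convolve-impulse : ∀ h → convolve 1 impulse h ≋ h
  convolve-impulse h z = trans (+-identityˡ _) (trans (*-identityˡ _) (reindex h (ℤ.+-identityʳ z)))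

  convolve-extend : ∀ {B B'} c h → VanishesFrom c B → B ≤ B' → convolve B' c h ≋ convolve B c h
  convolve-extend c h c≈0 B≤B' z = Σ-extend _ B≤B' (λ j B≤j → trans (*-congʳ (c≈0 j B≤j)) (zeroˡ _))

  convolve-delay : ∀ B c h → Causal c → ∀ z → convolve (suc B) (λ y → c (ℤ.pred y)) h z ≈ convolve B c h (ℤ.suc z)
  convolve-delay B c h c₋≈0 z = begin
    Σ< (suc B) (λ j → c (ℤ.pred (+ j)) * h (z ℤ.+ + j))
      ≈⟨ Σ-head B _ ⟩
    c -[1+ 0 ] * h (z ℤ.+ + 0) + Σ< B (λ j → c (+ j) * h (z ℤ.+ + suc j))
      ≈⟨ +-cong (trans (*-congʳ (c₋≈0 0)) (zeroˡ _)) (Σ-cong B (λ j → *-congˡ (reindex h (z+[1+j]≡suc[z]+j j)))) ⟩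
    0# + convolve B c h (ℤ.suc z)
      ≈⟨ +-identityˡ _ ⟩
    convolve B c h (ℤ.suc z) ∎
    where
    z+[1+j]≡suc[z]+j : ∀ j → z ℤ.+ + suc j ≡ ℤ.suc z ℤ.+ + j
    z+[1+j]≡suc[z]+j j = ≡.trans (≡.sym (ℤ.+-assoc z ℤ.1ℤ (+ j))) (≡.cong (ℤ._+ + j) (ℤ.+-comm z ℤ.1ℤ))

  Δ-convolve : ∀ B c h → VanishesFrom c B → Causal c → Δ (convolve B c h) ≋ convolve (suc B) (∇ 1# c) h
  Δ-convolve B c h c≈0 c₋≈0 z = sym (begin
    Σ< (suc B) (λ j → (c (+ j) - 1# * c (ℤ.pred (+ j))) * h (z ℤ.+ + j))
      ≈⟨ Σ-cong (suc B) (λ j → solve 3 (λ x y u → (x :- con ℤ.1ℤ :* y) :* u := x :* u :- y :* u) refl _ _ _) ⟩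
    Σ< (suc B) (λ j → c (+ j) * h (z ℤ.+ + j) - c (ℤ.pred (+ j)) * h (z ℤ.+ + j))
      ≈⟨ Σ-sub (suc B) _ _ ⟩
    convolve (suc B) c h z - convolve (suc B) (λ y → c (ℤ.pred y)) h z
      ≈⟨ +-cong (convolve-extend c h c≈0 (ℕ.n≤1+n B) z) (-‿cong (convolve-delay B c h c₋≈0 z)) ⟩
    convolve B c h z - convolve B c h (ℤ.suc z) ∎)

  ∇1-vanishesFrom : ∀ c B → VanishesFrom c B → VanishesFrom (∇ 1# c) (suc B)
  ∇1-vanishesFrom c B c≈0 (suc j) (s≤s B≤j) = begin
    c (+ suc j) - 1# * c (+ j)  ≈⟨ +-cong (c≈0 (suc j) (ℕ.m≤n⇒m≤1+n B≤j)) (-‿cong (trans (*-identityˡ _) (c≈0 j B≤j))) ⟩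
    0# - 0#                     ≈⟨ -‿inverseʳ 0# ⟩
    0#                          ∎

  ∇1-causal : ∀ c → Causal c → Causal (∇ 1# c)
  ∇1-causal c c₋≈0 n = begin
    c -[1+ n ] - 1# * c -[1+ suc n ]  ≈⟨ +-cong (c₋≈0 n) (-‿cong (trans (*-identityˡ _) (c₋≈0 (suc n)))) ⟩
    0# - 0#                           ≈⟨ -‿inverseʳ 0# ⟩
    0#                                ∎

  ∇1-iter-vanishesFrom : ∀ k c B → VanishesFrom c B → VanishesFrom (iter (∇ 1#) k c) (k ℕ.+ B)
  ∇1-iter-vanishesFrom zero    c B c≈0 = c≈0
  ∇1-iter-vanishesFrom (suc k) c B c≈0 = ∇1-vanishesFrom (iter (∇ 1#) k c) (k ℕ.+ B) (∇1-iter-vanishesFrom k c B c≈0)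

  ∇1-iter-causal : ∀ k c → Causal c → Causal (iter (∇ 1#) k c)
  ∇1-iter-causal zero    c c₋≈0 = c₋≈0
  ∇1-iter-causal (suc k) c c₋≈0 = ∇1-causal (iter (∇ 1#) k c) (∇1-iter-causal k c c₋≈0)

  Δ-iter-convolve : ∀ k B c h → VanishesFrom c B → Causal c →
    iter Δ k (convolve B c h) ≋ convolve (k ℕ.+ B) (iter (∇ 1#) k c) h
  Δ-iter-convolve zero    B c h c≈0 c₋≈0 z = refl
  Δ-iter-convolve (suc k) B c h c≈0 c₋≈0 z = begin
    Δ (iter Δ k (convolve B c h)) z
      ≈⟨ ≋-cong Δ-linear (Δ-iter-convolve k B c h c≈0 c₋≈0) z ⟩
    Δ (convolve (k ℕ.+ B) (iter (∇ 1#) k c) h) z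
      ≈⟨ Δ-convolve (k ℕ.+ B) (iter (∇ 1#) k c) h (∇1-iter-vanishesFrom k c B c≈0) (∇1-iter-causal k c c₋≈0) z ⟩
    convolve (suc k ℕ.+ B) (iter (∇ 1#) (suc k) c) h z ∎

  convolve-Σ : ∀ B n (a : ℕ → Carrier) (c : ℕ → Seq) h z →
    convolve B (λ y → Σ< n (λ i → a i * c i y)) h z ≈ Σ< n (λ i → a i * convolve B (c i) h z)
  convolve-Σ B n a c h z = begin
    Σ< B (λ j → Σ< n (λ i → a i * c i (+ j)) * h (z ℤ.+ + j)) ≈⟨ Σ-cong B (λ j → Σ-*ʳ n _ _) ⟨
    Σ< B (λ j → Σ< n (λ i → a i * c i (+ j) * h (z ℤ.+ + j))) ≈⟨ Σ-comm B n _ ⟩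
    Σ< n (λ i → Σ< B (λ j → a i * c i (+ j) * h (z ℤ.+ + j))) ≈⟨ Σ-cong n (λ i → trans (Σ-cong B (λ j → *-assoc _ _ _)) (Σ-*ˡ B _ _)) ⟩
    Σ< n (λ i → a i * convolve B (c i) h z)                  ∎

  convolve-+* : ∀ B c d a h z → convolve B (λ y → c y + a * d y) h z ≈ convolve B c h z + a * convolve B d h z
  convolve-+* B c d a h z = begin
    Σ< B (λ j → (c (+ j) + a * d (+ j)) * h (z ℤ.+ + j))
      ≈⟨ Σ-cong B (λ j → solve 4 (λ x a y u → (x :+ a :* y) :* u := x :* u :+ a :* (y :* u)) refl _ a _ _) ⟩
    Σ< B (λ j → c (+ j) * h (z ℤ.+ + j) + a * (d (+ j) * h (z ℤ.+ + j)))
      ≈⟨ trans (Σ-+ B _ _) (+-congˡ (Σ-*ˡ B a _)) ⟩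
    convolve B c h z + a * convolve B d h z ∎

  convolve-congᶜ : ∀ B {c d} → (∀ j → c (+ j) ≈ d (+ j)) → ∀ h → convolve B c h ≋ convolve B d h
  convolve-congᶜ B c≈d h z = Σ-cong B (λ j → *-congʳ (c≈d j))

  -- Eulerian numbers as iterated differences of powers

  powerSeq : ℕ → Seq
  powerSeq s (+ n)    = fromℕ (n ^ s)
  powerSeq s -[1+ n ] = 0#

  eulerianSeq : ℕ → Seq
  eulerianSeq s = iter (∇ 1#) (suc s) (powerSeq s)

  eulerianSeq-causal : ∀ s → Causal (eulerianSeq s)
  eulerianSeq-causal s = ∇1-iter-causal (suc s) (powerSeq s) (λ _ → refl)

  ∇1-iter-annihilates-mul-id : ∀ e h → iter (∇ 1#) e h ≋ (λ _ → 0#) →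
    iter (∇ 1#) (suc e) (λ z → fromℤ z * h z) ≋ (λ _ → 0#)
  ∇1-iter-annihilates-mul-id zero h h≈0 z = begin
    fromℤ z * h z - 1# * (fromℤ (ℤ.pred z) * h (ℤ.pred z))
      ≈⟨ +-cong (*-congˡ (h≈0 z)) (-‿cong (*-congˡ (*-congˡ (h≈0 _)))) ⟩
    fromℤ z * 0# - 1# * (fromℤ (ℤ.pred z) * 0#)
      ≈⟨ solve 2 (λ x y → x :* con (+ 0) :- con ℤ.1ℤ :* (y :* con (+ 0)) := con (+ 0)) refl _ _ ⟩
    0# ∎
  ∇1-iter-annihilates-mul-id (suc e) h ∇ᵉ⁺¹h≈0 z = begin
    iter ∇1 (suc (suc e)) zh z                           ≡⟨ ≡.cong (λ g → g z) (iter-suc ∇1 (suc e) zh) ⟨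
    iter ∇1 (suc e) (∇1 zh) z                            ≈⟨ ≋-cong lin (∇1-mul-id) z ⟩
    iter ∇1 (suc e) (λ y → fromℤ y * ∇1 h y + h (ℤ.pred y)) z
      ≈⟨ +-hom lin _ _ z ⟩
    iter ∇1 (suc e) (λ y → fromℤ y * ∇1 h y) z + iter ∇1 (suc e) (λ y → h (ℤ.pred y)) z
      ≈⟨ +-cong (∇1-iter-annihilates-mul-id e (∇1 h) ∇ᵉ[∇h]≈0 z) delayed≈0 ⟩
    0# + 0#                                              ≈⟨ +-identityˡ _ ⟩
    0#                                                   ∎
    where
    ∇1 = ∇ 1#
    lin = iter-linear (∇-linear 1#) (suc e)
    zh = λ y → fromℤ y * h y
    ∇1-mul-id : ∇1 zh ≋ (λ y → fromℤ y * ∇1 h y + h (ℤ.pred y))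
    ∇1-mul-id y = begin
      fromℤ y * h y - 1# * (fromℤ (ℤ.pred y) * h (ℤ.pred y))           ≈⟨ +-congˡ (-‿cong (*-congˡ (*-congʳ (fromℤ-+ ℤ.-1ℤ y)))) ⟩
      fromℤ y * h y - 1# * ((- (1# + 0#) + fromℤ y) * h (ℤ.pred y))
        ≈⟨ solve 3 (λ x a b → x :* a :- con ℤ.1ℤ :* ((:- (con ℤ.1ℤ :+ con (+ 0)) :+ x) :* b) := x :* (a :- con ℤ.1ℤ :* b) :+ b) refl (fromℤ y) (h y) (h (ℤ.pred y)) ⟩
      fromℤ y * ∇1 h y + h (ℤ.pred y)                                   ∎
    ∇ᵉ[∇h]≈0 : iter ∇1 e (∇1 h) ≋ (λ _ → 0#)
    ∇ᵉ[∇h]≈0 y = trans (reflexive (≡.cong (λ g → g y) (iter-suc ∇1 e h))) (∇ᵉ⁺¹h≈0 y)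
    delayed≈0 : iter ∇1 (suc e) (λ y → h (ℤ.pred y)) z ≈ 0#
    delayed≈0 = begin
      iter ∇1 (suc e) (λ y → h (ℤ.pred y)) z       ≈⟨ ≋-cong lin (λ y → reindex h (ℤ.+-comm ℤ.-1ℤ y)) z ⟩
      iter ∇1 (suc e) (λ y → h (y ℤ.+ ℤ.-1ℤ)) z    ≈⟨ shift-comm lin ℤ.-1ℤ h z ⟩
      iter ∇1 (suc e) h (z ℤ.+ ℤ.-1ℤ)              ≈⟨ ∇ᵉ⁺¹h≈0 _ ⟩
      0#                                           ∎

  ∇1-iter-annihilates-power : ∀ s → iter (∇ 1#) (suc s) (λ z → pow (fromℤ z) s) ≋ (λ _ → 0#)
  ∇1-iter-annihilates-power zero    z = solve 0 (con ℤ.1ℤ :- con ℤ.1ℤ :* con ℤ.1ℤ := con (+ 0)) refl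
  ∇1-iter-annihilates-power (suc s) = ∇1-iter-annihilates-mul-id (suc s) _ (∇1-iter-annihilates-power s)

  eulerianForm : Carrier → ℕ → Seq → Carrier
  eulerianForm q s h = Σ< (suc (suc s)) (λ i → sgn i * fromℕ (suc s C i) * pow q i * Σ< (suc s) (λ j → eulerA s j * h (+ j ℤ.- + i)))

  eulerianForm-cong : ∀ q s {h h'} → h ≋ h' → eulerianForm q s h ≈ eulerianForm q s h'
  eulerianForm-cong q s h≋h' = Σ-cong (suc (suc s)) (λ i → *-congˡ (Σ-cong (suc s) (λ j → *-congˡ (h≋h' _))))

  eulerianForm-lincomb : ∀ q s h₁ h₂ α β →
    eulerianForm q s (λ k → α * h₁ k + β * h₂ k) ≈ α * eulerianForm q s h₁ + β * eulerianForm q s h₂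
  eulerianForm-lincomb q s h₁ h₂ α β = begin
    Σ< (suc (suc s)) (λ i → wᵢ i * Σ< (suc s) (λ j → eulerA s j * (α * h₁ (kᵢⱼ i j) + β * h₂ (kᵢⱼ i j))))
      ≈⟨ Σ-cong (suc (suc s)) (λ i → *-congˡ (Σ-lincomb (suc s) (eulerA s) _ _ α β)) ⟩
    Σ< (suc (suc s)) (λ i → wᵢ i * (α * Σ< (suc s) (λ j → eulerA s j * h₁ (kᵢⱼ i j)) + β * Σ< (suc s) (λ j → eulerA s j * h₂ (kᵢⱼ i j))))
      ≈⟨ Σ-lincomb (suc (suc s)) wᵢ _ _ α β ⟩
    α * eulerianForm q s h₁ + β * eulerianForm q s h₂ ∎
    where
    wᵢ = λ i → sgn i * fromℕ (suc s C i) * pow q i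
    kᵢⱼ = λ i j → + j ℤ.- + i

  private
    +j-+t≡+[j∸t] : ∀ {j t} → t ≤ j → + j ℤ.- + t ≡ + (j ∸ t)
    +j-+t≡+[j∸t] {j} {t} t≤j = ≡.trans (ℤ.m-n≡m⊖n j t) (ℤ.⊖-≥ t≤j)

    +j-+t≡-[1+t∸[1+j]] : ∀ {j t} → j < t → + j ℤ.- + t ≡ -[1+ t ∸ suc j ]
    +j-+t≡-[1+t∸[1+j]] {j} {t} j<t =
      ≡.trans (ℤ.m-n≡m⊖n j t) (≡.trans (ℤ.⊖-< j<t) (≡.cong (λ n → ℤ.- + n) (ℕ.+-∸-assoc 1 j<t)))

  powerSeq≈power : ∀ s {j t} → t ≤ j → powerSeq s (+ j ℤ.- + t) ≈ pow (fromℤ (+ j ℤ.- + t)) s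
  powerSeq≈power s {j} {t} t≤j rewrite +j-+t≡+[j∸t] t≤j = fromℕ-^ (j ∸ t) s

  eulerianSeq-vanishesFrom : ∀ s → VanishesFrom (eulerianSeq s) (suc s)
  eulerianSeq-vanishesFrom s j s<j = begin
    eulerianSeq s (+ j)                                                 ≈⟨ ∇-iter-binomial 1# (suc s) (powerSeq s) (+ j) ⟩
    Σ< (suc (suc s)) (binomialTerm 1# (suc s) (powerSeq s) (+ j))
      ≈⟨ Σ-cong< (suc (suc s)) (λ t t<s+2 → *-congˡ (powerSeq≈power s (ℕ.≤-trans (ℕ.≤-pred t<s+2) s<j))) ⟩
    Σ< (suc (suc s)) (binomialTerm 1# (suc s) (λ z → pow (fromℤ z) s) (+ j)) ≈⟨ ∇-iter-binomial 1# (suc s) _ (+ j) ⟨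
    iter (∇ 1#) (suc s) (λ z → pow (fromℤ z) s) (+ j)                  ≈⟨ ∇1-iter-annihilates-power s (+ j) ⟩
    0#                                                                  ∎

  eulerianSeq≈eulerA : ∀ s j → eulerianSeq s (+ j) ≈ eulerA s j
  eulerianSeq≈eulerA s j = begin
    eulerianSeq s (+ j)                                             ≈⟨ ∇-iter-binomial 1# (suc s) (powerSeq s) (+ j) ⟩
    Σ< (suc (suc s)) (binomialTerm 1# (suc s) (powerSeq s) (+ j))
      ≈⟨ Σ-cong (suc (suc s)) (λ t → *-congʳ (trans (*-congˡ (pow-1# t)) (*-identityʳ _))) ⟩
    Σ< (suc (suc s)) g                                              ≈⟨ Σ-extend g (ℕ.m≤n+m (suc (suc s)) (suc j)) g≈0-beyond-s ⟨
    Σ< (suc j ℕ.+ suc (suc s)) g                                    ≈⟨ Σ-extend g (ℕ.m≤m+n (suc j) _) g≈0-beyond-j ⟩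
    Σ< (suc j) g
      ≈⟨ Σ-cong< (suc j) (λ t t≤j → trans (*-congˡ (reindex (powerSeq s) (+j-+t≡+[j∸t] (ℕ.≤-pred t≤j)))) (*-assoc _ _ _)) ⟩
    eulerA s j                                                      ∎
    where
    g : ℕ → Carrier
    g t = sgn t * fromℕ (suc s C t) * powerSeq s (+ j ℤ.- + t)
    g≈0-beyond-s : ∀ t → suc (suc s) ≤ t → g t ≈ 0#
    g≈0-beyond-s t s+1<t = begin
      sgn t * fromℕ (suc s C t) * _ ≡⟨ ≡.cong (λ n → sgn t * fromℕ n * powerSeq s (+ j ℤ.- + t)) (k>n⇒nCk≡0 s+1<t) ⟩
      sgn t * 0# * _                ≈⟨ trans (*-congʳ (zeroʳ _)) (zeroˡ _) ⟩
      0#                            ∎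
    g≈0-beyond-j : ∀ t → suc j ≤ t → g t ≈ 0#
    g≈0-beyond-j t j<t = trans (*-congˡ (reindex (powerSeq s) (+j-+t≡-[1+t∸[1+j]] j<t))) (zeroʳ _)

  module PowerSums (m : ℕ) where

    binomialWeight : ℕ → ℕ → Carrier
    binomialWeight t s = fromℕ (m C s) * fromℕ (t ^ (m ∸ s))

    shiftedPowerSeq : ℕ → Seq
    shiftedPowerSeq t (+ n)    = fromℕ ((n ℕ.+ t) ^ m)
    shiftedPowerSeq t -[1+ n ] = 0#

    shiftedPowerSeq-expansion : ∀ t → shiftedPowerSeq t ≋ (λ z → Σ< (suc m) (λ s → binomialWeight t s * powerSeq s z))
    shiftedPowerSeq-expansion t (+ n)    = fromℕ-binomial n t m
    shiftedPowerSeq-expansion t -[1+ n ] = sym (Σ-zero (suc m) (λ s → zeroʳ _))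

    shiftedPowerSeq-step : ∀ t → (λ y → shiftedPowerSeq t y - shiftedPowerSeq (suc t) (ℤ.pred y)) ≋ (λ y → fromℕ (t ^ m) * impulse y)
    shiftedPowerSeq-step t (+ zero)  = trans (+-congˡ -0#≈0#) (trans (+-identityʳ _) (sym (*-identityʳ _)))
    shiftedPowerSeq-step t (+ suc n) = begin
      fromℕ ((suc n ℕ.+ t) ^ m) - fromℕ ((n ℕ.+ suc t) ^ m)  ≡⟨ ≡.cong (λ k → fromℕ ((suc n ℕ.+ t) ^ m) - fromℕ (k ^ m)) (ℕ.+-suc n t) ⟩
      fromℕ ((suc n ℕ.+ t) ^ m) - fromℕ ((suc n ℕ.+ t) ^ m)  ≈⟨ -‿inverseʳ _ ⟩
      0#                                                     ≈⟨ zeroʳ _ ⟨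
      fromℕ (t ^ m) * 0#                                     ∎
    shiftedPowerSeq-step t -[1+ n ]  = trans (+-congˡ -0#≈0#) (trans (+-identityʳ _) (sym (zeroʳ _)))

    Q : ℕ → Seq
    Q t z = Σ< (suc m) (λ s → binomialWeight t s * iter (∇ 1#) (m ∸ s) (eulerianSeq s) z)

    Q≈∇-iter-shiftedPowerSeq : ∀ t → Q t ≋ iter (∇ 1#) (suc m) (shiftedPowerSeq t)
    Q≈∇-iter-shiftedPowerSeq t z = begin
      Σ< (suc m) (λ s → binomialWeight t s * iter ∇1 (m ∸ s) (eulerianSeq s) z)
        ≈⟨ Σ-cong< (suc m) (λ s s≤m → *-congˡ (reflexive (≡.cong (λ g → g z) (∇1-iter-eulerianSeq (ℕ.≤-pred s≤m))))) ⟩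
      Σ< (suc m) (λ s → binomialWeight t s * iter ∇1 (suc m) (powerSeq s) z)
        ≈⟨ Σ-hom lin (suc m) (binomialWeight t) powerSeq z ⟨
      iter ∇1 (suc m) (λ y → Σ< (suc m) (λ s → binomialWeight t s * powerSeq s y)) z
        ≈⟨ ≋-cong lin (λ y → sym (shiftedPowerSeq-expansion t y)) z ⟩
      iter ∇1 (suc m) (shiftedPowerSeq t) z ∎
      where
      ∇1 = ∇ 1#
      lin = iter-linear (∇-linear 1#) (suc m)
      ∇1-iter-eulerianSeq : ∀ {s} → s ≤ m → iter ∇1 (m ∸ s) (eulerianSeq s) ≡ iter ∇1 (suc m) (powerSeq s)
      ∇1-iter-eulerianSeq {s} s≤m = ≡.trans (≡.sym (iter-+ ∇1 (m ∸ s) (suc s) (powerSeq s)))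
                                            (≡.cong (λ k → iter ∇1 k (powerSeq s)) ([m∸s]+[1+s]≡1+m s≤m))

    Q-step : ∀ t z → Q t z - Q (suc t) (ℤ.pred z) ≈ fromℕ (t ^ m) * iter (∇ 1#) (suc m) impulse z
    Q-step t z = begin
      Q t z - Q (suc t) (ℤ.pred z)
        ≈⟨ +-cong (Q≈∇-iter-shiftedPowerSeq t z) (-‿cong (trans (Q≈∇-iter-shiftedPowerSeq (suc t) _) (reindex (iter ∇1 (suc m) P₊) (ℤ.+-comm ℤ.-1ℤ z)))) ⟩
      iter ∇1 (suc m) P z - iter ∇1 (suc m) P₊ (z ℤ.+ ℤ.-1ℤ)
        ≈⟨ +-congˡ (-‿cong (shift-comm lin ℤ.-1ℤ P₊ z)) ⟨
      iter ∇1 (suc m) P z - iter ∇1 (suc m) (λ y → P₊ (y ℤ.+ ℤ.-1ℤ)) z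
        ≈⟨ sub-hom lin _ _ z ⟨
      iter ∇1 (suc m) (λ y → P y - P₊ (y ℤ.+ ℤ.-1ℤ)) z
        ≈⟨ ≋-cong lin (λ y → trans (+-congˡ (-‿cong (reindex P₊ (ℤ.+-comm y ℤ.-1ℤ)))) (shiftedPowerSeq-step t y)) z ⟩
      iter ∇1 (suc m) (λ y → fromℕ (t ^ m) * impulse y) z
        ≈⟨ *-hom lin _ impulse z ⟩
      fromℕ (t ^ m) * iter ∇1 (suc m) impulse z ∎
      where
      ∇1 = ∇ 1#
      lin = iter-linear (∇-linear 1#) (suc m)
      P = shiftedPowerSeq t
      P₊ = shiftedPowerSeq (suc t)

    Q-vanishesFrom : ∀ t → VanishesFrom (Q t) (suc m)
    Q-vanishesFrom t j m<j = Σ-zero< (suc m) (λ s s≤m → trans (*-congˡ (∇1-iter-vanishesFrom (m ∸ s) (eulerianSeq s) (suc s) (eulerianSeq-vanishesFrom s) j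
        (≡.subst (_≤ j) (≡.sym ([m∸s]+[1+s]≡1+m (ℕ.≤-pred s≤m))) m<j))) (zeroʳ _))

    Q-causal : ∀ t → Causal (Q t)
    Q-causal t n = Σ-zero (suc m) (λ s → trans (*-congˡ (∇1-iter-causal (m ∸ s) (eulerianSeq s) (eulerianSeq-causal s) n)) (zeroʳ _))

  -- Solutions of the second-order recurrence

  module Recurrence (p q : Carrier) where

    IsSolution : Seq → Set ℓ
    IsSolution h = ∀ z → h (ℤ.suc z) ≈ p * h z - q * h (ℤ.pred z)

    solution-resp : ∀ {f g} → f ≋ g → IsSolution f → IsSolution g
    solution-resp f≋g f-sol z = trans (sym (f≋g _)) (trans (f-sol z) (+-cong (*-congˡ (f≋g z)) (-‿cong (*-congˡ (f≋g _)))))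

    solution-0 : IsSolution (λ _ → 0#)
    solution-0 z = solve 2 (λ p q → con (+ 0) := p :* con (+ 0) :- q :* con (+ 0)) refl p q

    solution-+ : ∀ {f g} → IsSolution f → IsSolution g → IsSolution (λ z → f z + g z)
    solution-+ f-sol g-sol z = trans (+-cong (f-sol z) (g-sol z))
      (solve 6 (λ p q a b c d → (p :* a :- q :* b) :+ (p :* c :- q :* d) := p :* (a :+ c) :- q :* (b :+ d)) refl p q _ _ _ _)

    solution-* : ∀ {f} α → IsSolution f → IsSolution (λ z → α * f z)
    solution-* α f-sol z = trans (*-congˡ (f-sol z))
      (solve 5 (λ α p q a b → α :* (p :* a :- q :* b) := p :* (α :* a) :- q :* (α :* b)) refl α p q _ _)

    solution-neg : ∀ {f} → IsSolution f → IsSolution (λ z → - f z)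
    solution-neg f-sol z = trans (-‿cong (f-sol z))
      (solve 4 (λ p q a b → :- (p :* a :- q :* b) := p :* (:- a) :- q :* (:- b)) refl p q _ _)

    solution-Σ : ∀ n (a : ℕ → Carrier) {F : ℕ → Seq} → (∀ i → IsSolution (F i)) →
      IsSolution (λ z → Σ< n (λ i → a i * F i z))
    solution-Σ zero    a F-sol = solution-0
    solution-Σ (suc n) a F-sol = solution-+ (solution-Σ n a F-sol) (solution-* (a n) (F-sol n))

    solution-shift : ∀ {f} k → IsSolution f → IsSolution (λ z → f (z ℤ.+ k))
    solution-shift {f} k f-sol z =
      trans (reindex f (ℤ.+-assoc ℤ.1ℤ z k)) (trans (f-sol (z ℤ.+ k)) (+-congˡ (-‿cong (*-congˡ (reindex f (≡.sym (ℤ.pred-+ z k)))))))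

    linear-preserves-solution : ∀ {F f} → ShiftInvariantLinear F → IsSolution f → IsSolution (F f)
    linear-preserves-solution {F} {f} lF f-sol z = begin
      F f (ℤ.suc z)                                        ≈⟨ reindex (F f) (ℤ.+-comm ℤ.1ℤ z) ⟩
      F f (z ℤ.+ ℤ.1ℤ)                                     ≈⟨ shift-comm lF ℤ.1ℤ f z ⟨
      F (λ y → f (y ℤ.+ ℤ.1ℤ)) z                           ≈⟨ ≋-cong lF recurrence z ⟩
      F (λ y → p * f y - q * f (y ℤ.+ ℤ.-1ℤ)) z            ≈⟨ sub-hom lF _ _ z ⟩
      F (λ y → p * f y) z - F (λ y → q * f (y ℤ.+ ℤ.-1ℤ)) z ≈⟨ +-cong (*-hom lF p f z) (-‿cong (*-hom lF q _ z)) ⟩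
      p * F f z - q * F (λ y → f (y ℤ.+ ℤ.-1ℤ)) z          ≈⟨ +-congˡ (-‿cong (*-congˡ (shift-comm lF ℤ.-1ℤ f z))) ⟩
      p * F f z - q * F f (z ℤ.+ ℤ.-1ℤ)                    ≈⟨ +-congˡ (-‿cong (*-congˡ (reindex (F f) (ℤ.+-comm z ℤ.-1ℤ)))) ⟩
      p * F f z - q * F f (ℤ.pred z)                       ∎
      where
      recurrence : (λ y → f (y ℤ.+ ℤ.1ℤ)) ≋ (λ y → p * f y - q * f (y ℤ.+ ℤ.-1ℤ))
      recurrence y = trans (reindex f (ℤ.+-comm y ℤ.1ℤ))
        (trans (f-sol y) (+-congˡ (-‿cong (*-congˡ (reindex f (ℤ.+-comm ℤ.-1ℤ y))))))

    module _ (qinv : Carrier) (q*qinv≈1 : q * qinv ≈ 1#) where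

      solution-pred : ∀ {f} → IsSolution f → ∀ z → f (ℤ.pred z) ≈ (p * f z - f (ℤ.suc z)) * qinv
      solution-pred {f} f-sol z = begin
        f (ℤ.pred z)                                   ≈⟨ *-identityˡ _ ⟨
        1# * f (ℤ.pred z)                              ≈⟨ *-congʳ (trans (*-comm _ _) q*qinv≈1) ⟨
        (qinv * q) * f (ℤ.pred z)                      ≈⟨ trans (*-assoc _ _ _) (*-comm _ _) ⟩
        (q * f (ℤ.pred z)) * qinv                      ≈⟨ *-congʳ (solve 3 (λ u v x → x := u :- (u :- x)) refl (p * f z) (f (ℤ.suc z)) _) ⟩
        (p * f z - (p * f z - q * f (ℤ.pred z))) * qinv ≈⟨ *-congʳ (+-congˡ (-‿cong (f-sol z))) ⟨
        (p * f z - f (ℤ.suc z)) * qinv                 ∎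

      solution-unique : ∀ {f g} → IsSolution f → IsSolution g → f (+ 0) ≈ g (+ 0) → f (+ 1) ≈ g (+ 1) → f ≋ g
      solution-unique {f} {g} f-sol g-sol f₀≈g₀ f₁≈g₁ = agree
        where
        upward : ∀ n → f (+ n) ≈ g (+ n) × f (+ suc n) ≈ g (+ suc n)
        upward zero    = f₀≈g₀ , f₁≈g₁
        upward (suc n) with upward n
        ... | fₙ≈gₙ , fₙ₊₁≈gₙ₊₁ =
          fₙ₊₁≈gₙ₊₁ , trans (f-sol (+ suc n)) (trans (+-cong (*-congˡ fₙ₊₁≈gₙ₊₁) (-‿cong (*-congˡ fₙ≈gₙ))) (sym (g-sol (+ suc n))))
        step-down : ∀ z → f z ≈ g z → f (ℤ.suc z) ≈ g (ℤ.suc z) → f (ℤ.pred z) ≈ g (ℤ.pred z)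
        step-down z f≈g f₊≈g₊ = trans (solution-pred f-sol z)
          (trans (*-congʳ (+-cong (*-congˡ f≈g) (-‿cong f₊≈g₊))) (sym (solution-pred g-sol z)))
        downward : ∀ n → f -[1+ n ] ≈ g -[1+ n ] × f (ℤ.suc -[1+ n ]) ≈ g (ℤ.suc -[1+ n ])
        downward zero    = step-down (+ 0) f₀≈g₀ f₁≈g₁ , f₀≈g₀
        downward (suc n) with downward n
        ... | f≈g , f₊≈g₊ = step-down -[1+ n ] f≈g f₊≈g₊ , f≈g
        agree : f ≋ g
        agree (+ n)    = proj₁ (upward n)
        agree -[1+ n ] = proj₁ (downward n)

      backward-step-inverse : ∀ x y → y ≈ p * x - q * ((p * x - y) * qinv)
      backward-step-inverse x y = begin
        y                                ≈⟨ solve 2 (λ u y → y := u :- (u :- y)) refl (p * x) y ⟩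
        p * x - (p * x - y)              ≈⟨ +-congˡ (-‿cong q*[u*qinv]≈u) ⟨
        p * x - q * ((p * x - y) * qinv) ∎
        where
        q*[u*qinv]≈u : q * ((p * x - y) * qinv) ≈ p * x - y
        q*[u*qinv]≈u = begin
          q * ((p * x - y) * qinv)  ≈⟨ *-congˡ (*-comm _ _) ⟩
          q * (qinv * (p * x - y))  ≈⟨ *-assoc _ _ _ ⟨
          (q * qinv) * (p * x - y)  ≈⟨ trans (*-congʳ q*qinv≈1) (*-identityˡ _) ⟩
          p * x - y                 ∎

      horadam-solution : ∀ a b → IsSolution (w a b p q qinv)
      horadam-solution a b (+ zero)     = backward-step-inverse _ _
      horadam-solution a b (+ suc n)    = refl
      horadam-solution a b -[1+ zero ]  = backward-step-inverse _ _
      horadam-solution a b -[1+ suc n ] = backward-step-inverse _ _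

      U-expansion : ∀ {f} → IsSolution f → ∀ N k → U p q qinv k * f (ℤ.suc N) - q * U p q qinv (ℤ.pred k) * f N ≈ f (N ℤ.+ k)
      U-expansion {f} f-sol N = solution-unique lhs-sol rhs-sol at-0 at-1
        where
        UU = U p q qinv
        U-sol : IsSolution UU
        U-sol = horadam-solution 0# 1#
        lhs-sol : IsSolution (λ k → UU k * f (ℤ.suc N) - q * UU (ℤ.pred k) * f N)
        lhs-sol = solution-resp
          (λ k → trans (+-congˡ (*-congˡ (reindex UU (ℤ.+-comm k ℤ.-1ℤ))))
            (solve 5 (λ x y u v q → x :* u :+ (:- (q :* y)) :* v := u :* x :- q :* v :* y) refl _ _ _ _ q))
          (solution-+ (solution-* (f (ℤ.suc N)) U-sol) (solution-* (- (q * f N)) (solution-shift ℤ.-1ℤ U-sol)))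
        rhs-sol : IsSolution (λ k → f (N ℤ.+ k))
        rhs-sol = solution-resp (λ k → reindex f (ℤ.+-comm k N)) (solution-shift N f-sol)
        at-0 : UU (+ 0) * f (ℤ.suc N) - q * UU (ℤ.pred (+ 0)) * f N ≈ f (N ℤ.+ + 0)
        at-0 = begin
          0# * f (ℤ.suc N) - q * ((p * 0# - 1#) * qinv) * f N
            ≈⟨ solve 5 (λ x y z p q → con (+ 0) :* x :- q :* ((p :* con (+ 0) :- con ℤ.1ℤ) :* y) :* z := q :* y :* z) refl _ qinv _ p q ⟩
          q * qinv * f N  ≈⟨ trans (*-congʳ q*qinv≈1) (*-identityˡ _) ⟩
          f N             ≈⟨ reindex f (ℤ.+-identityʳ N) ⟨
          f (N ℤ.+ + 0)   ∎
        at-1 : UU (+ 1) * f (ℤ.suc N) - q * UU (ℤ.pred (+ 1)) * f N ≈ f (N ℤ.+ + 1)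
        at-1 = trans (solve 3 (λ x y q → con ℤ.1ℤ :* x :- q :* con (+ 0) :* y := x) refl _ _ q) (reindex f (ℤ.+-comm ℤ.1ℤ N))

    module _ (dinv : Carrier) (d*dinv≈1 : (1# - p + q) * dinv ≈ 1#) where

      L : Seq → Seq
      L h z = dinv * ∇ q h z

      L-linear : ShiftInvariantLinear L
      L-linear = record
        { ≋-cong     = λ f≋g z → *-congˡ (≋-cong ∇q f≋g z)
        ; +-hom      = λ f g z → trans (*-congˡ (+-hom ∇q f g z)) (distribˡ _ _ _)
        ; *-hom      = λ a f z → trans (*-congˡ (*-hom ∇q a f z)) (solve 3 (λ d a x → d :* (a :* x) := a :* (d :* x)) refl dinv a _)
        ; shift-comm = λ k f z → *-congˡ (shift-comm ∇q k f z)
        }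
        where ∇q = ∇-linear q

      private
        dinv-cancel : ∀ x → dinv * ((1# - p + q) * x) ≈ x
        dinv-cancel x = trans (sym (*-assoc _ _ _)) (trans (*-congʳ (trans (*-comm _ _) d*dinv≈1)) (*-identityˡ _))

      Δ-L-inverse : ∀ {f} → IsSolution f → Δ (L f) ≋ f
      Δ-L-inverse {f} f-sol z = begin
        dinv * (f z - q * f (ℤ.pred z)) - dinv * (f (ℤ.suc z) - q * f (ℤ.pred (ℤ.suc z)))
          ≈⟨ +-congˡ (-‿cong (*-congˡ (+-cong (f-sol z) (-‿cong (*-congˡ (reindex f (ℤ.pred-suc z))))))) ⟩
        dinv * (f z - q * f (ℤ.pred z)) - dinv * ((p * f z - q * f (ℤ.pred z)) - q * f z)
          ≈⟨ solve 5 (λ d p q a b → d :* (a :- q :* b) :- d :* ((p :* a :- q :* b) :- q :* a) := d :* ((con ℤ.1ℤ :- p :+ q) :* a)) refl dinv p q _ _ ⟩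
        dinv * ((1# - p + q) * f z) ≈⟨ dinv-cancel _ ⟩
        f z ∎

      L-Δ-inverse : ∀ {f} → IsSolution f → L (Δ f) ≋ f
      L-Δ-inverse {f} f-sol z = begin
        dinv * ((f z - f (ℤ.suc z)) - q * (f (ℤ.pred z) - f (ℤ.suc (ℤ.pred z))))
          ≈⟨ *-congˡ (+-cong (+-congˡ (-‿cong (f-sol z))) (-‿cong (*-congˡ (+-congˡ (-‿cong (reindex f (ℤ.suc-pred z))))))) ⟩
        dinv * ((f z - (p * f z - q * f (ℤ.pred z))) - q * (f (ℤ.pred z) - f z))
          ≈⟨ *-congˡ (solve 4 (λ p q a b → (a :- (p :* a :- q :* b)) :- q :* (b :- a) := (con ℤ.1ℤ :- p :+ q) :* a) refl p q _ _) ⟩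
        dinv * ((1# - p + q) * f z) ≈⟨ dinv-cancel _ ⟩
        f z ∎

      Δ-iter-L-iter-inverse : ∀ k {f} → IsSolution f → iter Δ k (iter L k f) ≋ f
      Δ-iter-L-iter-inverse zero    f-sol z = refl
      Δ-iter-L-iter-inverse (suc k) {f} f-sol z = begin
        Δ (iter Δ k (L (iter L k f))) z  ≡⟨ ≡.cong (λ g → g z) (iter-suc Δ k _) ⟨
        iter Δ k (Δ (L (iter L k f))) z  ≈⟨ ≋-cong (iter-linear Δ-linear k) (Δ-L-inverse Lᵏf-sol) z ⟩
        iter Δ k (iter L k f) z          ≈⟨ Δ-iter-L-iter-inverse k f-sol z ⟩
        f z                              ∎
        where Lᵏf-sol = linear-preserves-solution (iter-linear L-linear k) f-sol

      L-iter-Δ-iter-inverse : ∀ k {f} → IsSolution f → iter L k (iter Δ k f) ≋ f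
      L-iter-Δ-iter-inverse zero    f-sol z = refl
      L-iter-Δ-iter-inverse (suc k) {f} f-sol z = begin
        L (iter L k (Δ (iter Δ k f))) z  ≡⟨ ≡.cong (λ g → g z) (iter-suc L k _) ⟨
        iter L k (L (Δ (iter Δ k f))) z  ≈⟨ ≋-cong (iter-linear L-linear k) (L-Δ-inverse Δᵏf-sol) z ⟩
        iter L k (iter Δ k f) z          ≈⟨ L-iter-Δ-iter-inverse k f-sol z ⟩
        f z                              ∎
        where Δᵏf-sol = linear-preserves-solution (iter-linear Δ-linear k) f-sol

      solution-Δ-iter-zero : ∀ k {f} → IsSolution f → iter Δ k f ≋ (λ _ → 0#) → f ≋ (λ _ → 0#)
      solution-Δ-iter-zero k {f} f-sol Δᵏf≈0 z = begin
        f z                         ≈⟨ L-iter-Δ-iter-inverse k f-sol z ⟨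
        iter L k (iter Δ k f) z     ≈⟨ ≋-cong (iter-linear L-linear k) Δᵏf≈0 z ⟩
        iter L k (λ _ → 0#) z       ≈⟨ 0-hom (iter-linear L-linear k) z ⟩
        0#                          ∎

  -- Telescoping the power-weighted sum

  module Telescoping (p q dinv : Carrier) (d*dinv≈1 : (1# - p + q) * dinv ≈ 1#) (m : ℕ) (f : Seq) where
    open PowerSums m
    open Recurrence p q

    G : ℕ → Seq
    G s = iter (L dinv d*dinv≈1) (suc s) (convolve (suc s) (eulerianSeq s) f)

    H : ℕ → Seq
    H t z = Σ< (suc m) (λ s → binomialWeight t s * G s z)

    G-closed-form : ∀ s N → G s N ≈ pow dinv (suc s) * eulerianForm q s (λ k → f (k ℤ.+ N))
    G-closed-form s N = begin
      G s N                                                        ≈⟨ iter-scaled (∇-linear q) dinv (suc s) X N ⟩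
      pow dinv (suc s) * iter (∇ q) (suc s) X N                    ≈⟨ *-congˡ (∇-iter-binomial q (suc s) X N) ⟩
      pow dinv (suc s) * Σ< (suc (suc s)) (binomialTerm q (suc s) X N)
        ≈⟨ *-congˡ (Σ-cong (suc (suc s)) (λ i → *-congˡ (Σ-cong (suc s) (λ j →
             *-cong (eulerianSeq≈eulerA s j) (reindex f ([N-i]+j≡[j-i]+N N (+ i) (+ j))))))) ⟩
      pow dinv (suc s) * eulerianForm q s (λ k → f (k ℤ.+ N))       ∎
      where X = convolve (suc s) (eulerianSeq s) f

    G-0 : ∀ z → G 0 z ≈ dinv * (f z - q * f (ℤ.pred z))
    G-0 z = *-congˡ (+-cong (X≈f z) (-‿cong (*-congˡ (X≈f (ℤ.pred z)))))
      where
      X≈f : convolve 1 (eulerianSeq 0) f ≋ f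
      X≈f y = begin
        0# + ((1# + 0#) - 1# * 0#) * f (y ℤ.+ + 0)  ≈⟨ +-identityˡ _ ⟩
        ((1# + 0#) - 1# * 0#) * f (y ℤ.+ + 0)       ≈⟨ *-cong (solve 0 ((con ℤ.1ℤ :+ con (+ 0)) :- con ℤ.1ℤ :* con (+ 0) := con ℤ.1ℤ) refl)
                                                               (reindex f (ℤ.+-identityʳ y)) ⟩
        1# * f y                                    ≈⟨ *-identityˡ _ ⟩
        f y                                         ∎

    H-0 : ∀ z → H 0 z ≈ G m z
    H-0 z = begin
      Σ< m (λ s → binomialWeight 0 s * G s z) + binomialWeight 0 m * G m z
        ≈⟨ +-congʳ (Σ-zero< m (λ s s<m → trans (*-congʳ (zero-weight s<m)) (zeroˡ _))) ⟩
      0# + fromℕ (m C m) * fromℕ (0 ^ (m ∸ m)) * G m z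
        ≡⟨ ≡.cong₂ (λ a b → 0# + fromℕ a * fromℕ (0 ^ b) * G m z) (nCn≡1 m) (ℕ.n∸n≡0 m) ⟩
      0# + (1# + 0#) * (1# + 0#) * G m z
        ≈⟨ solve 1 (λ g → con (+ 0) :+ (con ℤ.1ℤ :+ con (+ 0)) :* (con ℤ.1ℤ :+ con (+ 0)) :* g := g) refl _ ⟩
      G m z ∎
      where
      zero-weight : ∀ {s} → s < m → binomialWeight 0 s ≈ 0#
      zero-weight s<m = trans (*-congˡ (reflexive (≡.cong fromℕ (0^[m∸s]≡0 s<m)))) (zeroʳ _)

    H-closed-form : ∀ n z →
      H n z ≈ fromℕ (n ^ m) * (dinv * (f z - q * f (ℤ.pred z))) + Σ< m (λ s → binomialWeight n (suc s) * G (suc s) z)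
    H-closed-form n z = begin
      H n z                                                              ≈⟨ Σ-head m _ ⟩
      binomialWeight n 0 * G 0 z + Σ< m (λ s → binomialWeight n (suc s) * G (suc s) z)
        ≈⟨ +-congʳ (*-cong (trans (*-congʳ (+-identityʳ 1#)) (*-identityˡ _)) (G-0 z)) ⟩
      fromℕ (n ^ m) * (dinv * (f z - q * f (ℤ.pred z))) + Σ< m (λ s → binomialWeight n (suc s) * G (suc s) z) ∎

    module _ (f-sol : IsSolution f) where

      convolve-solution : ∀ B c → IsSolution (convolve B c f)
      convolve-solution B c = solution-Σ B (λ j → c (+ j)) (λ j → solution-shift (+ j) f-sol)

      H-solution : ∀ t → IsSolution (H t)
      H-solution t = solution-Σ (suc m) (binomialWeight t) (λ s →
        linear-preserves-solution (iter-linear (L-linear dinv d*dinv≈1) (suc s)) (convolve-solution (suc s) (eulerianSeq s)))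

      Δ-iter-G : ∀ {s} → s ≤ m → iter Δ (suc m) (G s) ≋ convolve (suc m) (iter (∇ 1#) (m ∸ s) (eulerianSeq s)) f
      Δ-iter-G {s} s≤m z = begin
        iter Δ (suc m) (G s) z
          ≡⟨ ≡.cong (λ k → iter Δ k (G s) z) ([m∸s]+[1+s]≡1+m s≤m) ⟨
        iter Δ ((m ∸ s) ℕ.+ suc s) (G s) z
          ≡⟨ ≡.cong (λ g → g z) (iter-+ Δ (m ∸ s) (suc s) (G s)) ⟩
        iter Δ (m ∸ s) (iter Δ (suc s) (G s)) z
          ≈⟨ ≋-cong (iter-linear Δ-linear (m ∸ s)) (Δ-iter-L-iter-inverse dinv d*dinv≈1 (suc s) (convolve-solution (suc s) (eulerianSeq s))) z ⟩
        iter Δ (m ∸ s) (convolve (suc s) (eulerianSeq s) f) z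
          ≈⟨ Δ-iter-convolve (m ∸ s) (suc s) (eulerianSeq s) f (eulerianSeq-vanishesFrom s) (eulerianSeq-causal s) z ⟩
        convolve ((m ∸ s) ℕ.+ suc s) (iter (∇ 1#) (m ∸ s) (eulerianSeq s)) f z
          ≡⟨ ≡.cong (λ B → convolve B (iter (∇ 1#) (m ∸ s) (eulerianSeq s)) f z) ([m∸s]+[1+s]≡1+m s≤m) ⟩
        convolve (suc m) (iter (∇ 1#) (m ∸ s) (eulerianSeq s)) f z ∎

      Δ-iter-H : ∀ t → iter Δ (suc m) (H t) ≋ convolve (suc m) (Q t) f
      Δ-iter-H t z = begin
        iter Δ (suc m) (H t) z
          ≈⟨ Σ-hom (iter-linear Δ-linear (suc m)) (suc m) (binomialWeight t) G z ⟩
        Σ< (suc m) (λ s → binomialWeight t s * iter Δ (suc m) (G s) z)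
          ≈⟨ Σ-cong< (suc m) (λ s s≤m → *-congˡ (Δ-iter-G (ℕ.≤-pred s≤m) z)) ⟩
        Σ< (suc m) (λ s → binomialWeight t s * convolve (suc m) (iter (∇ 1#) (m ∸ s) (eulerianSeq s)) f z)
          ≈⟨ convolve-Σ (suc m) (suc m) (binomialWeight t) (λ s → iter (∇ 1#) (m ∸ s) (eulerianSeq s)) f z ⟨
        convolve (suc m) (Q t) f z ∎

      private
        Δᵐ⁺¹ = iter-linear Δ-linear (suc m)

        Δ-iter-H-shifted : ∀ t → iter Δ (suc m) (λ z → H t (z ℤ.+ ℤ.1ℤ)) ≋ convolve (suc (suc m)) (λ y → Q t (ℤ.pred y)) f
        Δ-iter-H-shifted t y = begin
          iter Δ (suc m) (λ z → H t (z ℤ.+ ℤ.1ℤ)) y      ≈⟨ shift-comm Δᵐ⁺¹ ℤ.1ℤ (H t) y ⟩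
          iter Δ (suc m) (H t) (y ℤ.+ ℤ.1ℤ)             ≈⟨ Δ-iter-H t _ ⟩
          convolve (suc m) (Q t) f (y ℤ.+ ℤ.1ℤ)          ≈⟨ reindex (convolve (suc m) (Q t) f) (ℤ.+-comm y ℤ.1ℤ) ⟩
          convolve (suc m) (Q t) f (ℤ.suc y)            ≈⟨ convolve-delay (suc m) (Q t) f (Q-causal t) y ⟨
          convolve (suc (suc m)) (λ z → Q t (ℤ.pred z)) f y ∎

        Δ-iter-as-convolve : iter Δ (suc m) f ≋ convolve (suc (suc m)) (iter (∇ 1#) (suc m) impulse) f
        Δ-iter-as-convolve y = begin
          iter Δ (suc m) f y                                              ≈⟨ ≋-cong Δᵐ⁺¹ (convolve-impulse f) y ⟨
          iter Δ (suc m) (convolve 1 impulse f) y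
            ≈⟨ Δ-iter-convolve (suc m) 1 impulse f impulse-vanishesFrom impulse-causal y ⟩
          convolve (suc m ℕ.+ 1) (iter (∇ 1#) (suc m) impulse) f y
            ≡⟨ ≡.cong (λ B → convolve B (iter (∇ 1#) (suc m) impulse) f y) (ℕ.+-comm (suc m) 1) ⟩
          convolve (suc (suc m)) (iter (∇ 1#) (suc m) impulse) f y        ∎

        stepDefect : ℕ → Seq
        stepDefect t y = H t y - H (suc t) (y ℤ.+ ℤ.1ℤ) - fromℕ (t ^ m) * f y

        stepDefect-solution : ∀ t → IsSolution (stepDefect t)
        stepDefect-solution t = solution-+ (solution-+ (H-solution t) (solution-neg (solution-shift ℤ.1ℤ (H-solution (suc t)))))
                                           (solution-neg (solution-* (fromℕ (t ^ m)) f-sol))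

        Δ-iter-stepDefect : ∀ t → iter Δ (suc m) (stepDefect t) ≋ (λ _ → 0#)
        Δ-iter-stepDefect t y = begin
          iter Δ (suc m) (stepDefect t) y
            ≈⟨ trans (sub-hom Δᵐ⁺¹ _ _ y) (+-cong (sub-hom Δᵐ⁺¹ _ _ y) (-‿cong (*-hom Δᵐ⁺¹ cₜ f y))) ⟩
          iter Δ (suc m) (H t) y - iter Δ (suc m) (λ z → H (suc t) (z ℤ.+ ℤ.1ℤ)) y - cₜ * iter Δ (suc m) f y
            ≈⟨ +-cong (+-cong (trans (Δ-iter-H t y) (sym (convolve-extend (Q t) f (Q-vanishesFrom t) (ℕ.n≤1+n _) y)))
                              (-‿cong (Δ-iter-H-shifted (suc t) y)))
                      (-‿cong (*-congˡ (Δ-iter-as-convolve y))) ⟩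
          convolve B (Q t) f y - convolve B Qₜ₊₁⁻ f y - cₜ * convolve B ∇δ f y
            ≈⟨ +-congʳ (+-congʳ (convolve-congᶜ B {Q t} {λ x → Qₜ₊₁⁻ x + cₜ * ∇δ x} Q-split f y)) ⟩
          convolve B (λ x → Qₜ₊₁⁻ x + cₜ * ∇δ x) f y - convolve B Qₜ₊₁⁻ f y - cₜ * convolve B ∇δ f y
            ≈⟨ +-congʳ (+-congʳ (convolve-+* B Qₜ₊₁⁻ ∇δ cₜ f y)) ⟩
          convolve B Qₜ₊₁⁻ f y + cₜ * convolve B ∇δ f y - convolve B Qₜ₊₁⁻ f y - cₜ * convolve B ∇δ f y
            ≈⟨ solve 2 (λ a b → a :+ b :- a :- b := con (+ 0)) refl _ _ ⟩
          0# ∎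
          where
          cₜ = fromℕ (t ^ m)
          Qₜ₊₁⁻ = λ y → Q (suc t) (ℤ.pred y)
          ∇δ = iter (∇ 1#) (suc m) impulse
          B = suc (suc m)
          Q-split : ∀ j → Q t (+ j) ≈ Qₜ₊₁⁻ (+ j) + cₜ * ∇δ (+ j)
          Q-split j = trans (solve 2 (λ x y → x := y :+ (x :- y)) refl _ _) (+-congˡ (Q-step t (+ j)))

      H-step : ∀ t z → H t z - H (suc t) (ℤ.suc z) ≈ fromℕ (t ^ m) * f z
      H-step t z = begin
        H t z - H (suc t) (ℤ.suc z)             ≈⟨ +-congˡ (-‿cong (reindex (H (suc t)) (ℤ.+-comm ℤ.1ℤ z))) ⟩
        H t z - H (suc t) (z ℤ.+ ℤ.1ℤ)          ≈⟨ solve 3 (λ a b c → a :- b := (a :- b :- c) :+ c) refl _ _ _ ⟩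
        stepDefect t z + fromℕ (t ^ m) * f z
          ≈⟨ +-congʳ (solution-Δ-iter-zero dinv d*dinv≈1 (suc m) (stepDefect-solution t) (Δ-iter-stepDefect t) z) ⟩
        0# + fromℕ (t ^ m) * f z                ≈⟨ +-identityˡ _ ⟩
        fromℕ (t ^ m) * f z                     ∎

      power-weighted-sum-telescopes : ∀ n r →
        Σ< n (λ k → fromℕ (suc k ^ m) * f (+ suc k ℤ.+ r))
          ≈ H 0 r - H n (+ n ℤ.+ r) + fromℕ (n ^ m) * f (+ n ℤ.+ r) - fromℕ (0 ^ m) * f r
      power-weighted-sum-telescopes n r = begin
        Σ< n (λ k → g (suc k))               ≈⟨ solve 2 (λ x y → y := (x :+ y) :- x) refl (g 0) _ ⟩
        g 0 + Σ< n (λ k → g (suc k)) - g 0   ≈⟨ +-congʳ (Σ-head n g) ⟨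
        Σ< n g + g n - g 0                   ≈⟨ +-congʳ (+-congʳ (trans (Σ-cong n (λ k → sym (H-step' k))) (Σ-telescope n u))) ⟩
        u 0 - u n + g n - g 0
          ≈⟨ +-cong (+-congʳ (+-congʳ (reindex (H 0) (ℤ.+-identityˡ r)))) (-‿cong (*-congˡ (reindex f (ℤ.+-identityˡ r)))) ⟩
        H 0 r - u n + g n - fromℕ (0 ^ m) * f r ∎
        where
        u g : ℕ → Carrier
        u k = H k (+ k ℤ.+ r)
        g k = fromℕ (k ^ m) * f (+ k ℤ.+ r)
        H-step' : ∀ k → u k - u (suc k) ≈ g k
        H-step' k = trans (+-congˡ (-‿cong (reindex (H (suc k)) (ℤ.+-assoc ℤ.1ℤ (+ k) r)))) (H-step k (+ k ℤ.+ r))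

  module PowerWeightedSums (p q qinv dinv : Carrier) (q*qinv≈1 : q * qinv ≈ 1#) (d*dinv≈1 : (1# - p + q) * dinv ≈ 1#)
                           (m : ℕ) (f : Seq) (n : ℕ) (r : ℤ) where
    open Recurrence p q
    open Telescoping p q dinv d*dinv≈1 m f
    open PowerSums m using (binomialWeight)

    private
      M = + n ℤ.+ r
      nᵐ = fromℕ (n ^ m)
      UU = U p q qinv
      E₁ E₂ : ℕ → Carrier
      E₁ s = eulerianForm q s (λ k → UU (k ℤ.- ℤ.1ℤ))
      E₂ s = eulerianForm q s UU
      K : ℕ → Carrier
      K s = fromℕ (m C suc s) * fromℕ (n ^ (m ∸ suc s)) * pow dinv (suc (suc s))
      S₁ S₂ : Carrier
      S₁ = Σ< m (λ s → K s * E₁ (suc s))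
      S₂ = Σ< m (λ s → K s * E₂ (suc s))

    module _ (f-sol : IsSolution f) where

      eulerianForm-shifted-solution : ∀ s →
        eulerianForm q s (λ k → f (k ℤ.+ M)) ≈ f (M ℤ.+ ℤ.1ℤ) * E₂ s + (- (q * f M)) * E₁ s
      eulerianForm-shifted-solution s = begin
        eulerianForm q s (λ k → f (k ℤ.+ M))
          ≈⟨ eulerianForm-cong q s expand ⟩
        eulerianForm q s (λ k → f (M ℤ.+ ℤ.1ℤ) * UU k + (- (q * f M)) * UU (k ℤ.- ℤ.1ℤ))
          ≈⟨ eulerianForm-lincomb q s UU (λ k → UU (k ℤ.- ℤ.1ℤ)) _ _ ⟩
        f (M ℤ.+ ℤ.1ℤ) * E₂ s + (- (q * f M)) * E₁ s ∎
        where
        expand : ∀ k → f (k ℤ.+ M) ≈ f (M ℤ.+ ℤ.1ℤ) * UU k + (- (q * f M)) * UU (k ℤ.- ℤ.1ℤ)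
        expand k = begin
          f (k ℤ.+ M)                                         ≈⟨ reindex f (ℤ.+-comm k M) ⟩
          f (M ℤ.+ k)                                         ≈⟨ U-expansion qinv q*qinv≈1 f-sol M k ⟨
          UU k * f (ℤ.suc M) - q * UU (ℤ.pred k) * f M
            ≈⟨ +-cong (*-congˡ (reindex f (ℤ.+-comm ℤ.1ℤ M))) (-‿cong (*-congʳ (*-congˡ (reindex UU (ℤ.+-comm ℤ.-1ℤ k))))) ⟩
          UU k * f (M ℤ.+ ℤ.1ℤ) - q * UU (k ℤ.- ℤ.1ℤ) * f M
            ≈⟨ solve 5 (λ u x q v y → u :* x :- q :* v :* y := x :* u :+ (:- (q :* y)) :* v) refl _ _ q _ _ ⟩
          f (M ℤ.+ ℤ.1ℤ) * UU k + (- (q * f M)) * UU (k ℤ.- ℤ.1ℤ) ∎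

      H-at-end : H n M ≈ nᵐ * (dinv * (f M - q * f (ℤ.pred M))) + (f (M ℤ.+ ℤ.1ℤ) * S₂ + (- (q * f M)) * S₁)
      H-at-end = begin
        H n M
          ≈⟨ H-closed-form n M ⟩
        nᵐ * (dinv * (f M - q * f (ℤ.pred M))) + Σ< m (λ s → binomialWeight n (suc s) * G (suc s) M)
          ≈⟨ +-congˡ (Σ-cong m (λ s → trans (*-congˡ (G-closed-form (suc s) M)) (trans (sym (*-assoc _ _ _))
                (*-congˡ (eulerianForm-shifted-solution (suc s)))))) ⟩
        nᵐ * (dinv * (f M - q * f (ℤ.pred M))) + Σ< m (λ s → K s * (f (M ℤ.+ ℤ.1ℤ) * E₂ (suc s) + (- (q * f M)) * E₁ (suc s)))
          ≈⟨ +-congˡ (Σ-lincomb m K (λ s → E₂ (suc s)) (λ s → E₁ (suc s)) _ _) ⟩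
        nᵐ * (dinv * (f M - q * f (ℤ.pred M))) + (f (M ℤ.+ ℤ.1ℤ) * S₂ + (- (q * f M)) * S₁) ∎

      boundary-terms : nᵐ * f M - nᵐ * (dinv * (f M - q * f (ℤ.pred M))) ≈ nᵐ * q * dinv * f M - nᵐ * dinv * f (M ℤ.+ ℤ.1ℤ)
      boundary-terms = begin
        nᵐ * f M - nᵐ * (dinv * (f M - q * f (ℤ.pred M)))
          ≈⟨ +-congʳ (*-congˡ (trans (sym (*-identityʳ _)) (*-congˡ (sym d*dinv≈1)))) ⟩
        nᵐ * (f M * ((1# - p + q) * dinv)) - nᵐ * (dinv * (f M - q * f (ℤ.pred M)))
          ≈⟨ solve 6 (λ N x y d p q → N :* (x :* ((con ℤ.1ℤ :- p :+ q) :* d)) :- N :* (d :* (x :- q :* y))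
                                  := N :* q :* d :* x :- N :* d :* (p :* x :- q :* y)) refl nᵐ (f M) _ dinv p q ⟩
        nᵐ * q * dinv * f M - nᵐ * dinv * (p * f M - q * f (ℤ.pred M))
          ≈⟨ +-congˡ (-‿cong (*-congˡ (sym (trans (reindex f (ℤ.+-comm M ℤ.1ℤ)) (f-sol M))))) ⟩
        nᵐ * q * dinv * f M - nᵐ * dinv * f (M ℤ.+ ℤ.1ℤ) ∎

      power-weighted-solution-sum :
        Σ< n (λ k → fromℕ (suc k ^ m) * f (+ suc k ℤ.+ r))
          ≈ (nᵐ * q * dinv + q * S₁) * f M + (- (nᵐ * dinv) - S₂) * f (M ℤ.+ ℤ.1ℤ)
            + (- (f r * δ0 m) + pow dinv (suc m) * eulerianForm q m (λ k → f (k ℤ.+ r)))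
      power-weighted-solution-sum = begin
        Σ< n (λ k → fromℕ (suc k ^ m) * f (+ suc k ℤ.+ r))
          ≈⟨ power-weighted-sum-telescopes f-sol n r ⟩
        H 0 r - H n M + nᵐ * f M - fromℕ (0 ^ m) * f r
          ≈⟨ +-cong (+-cong (+-cong (trans (H-0 r) (G-closed-form m r)) (-‿cong H-at-end)) refl) (-‿cong (*-congʳ (fromℕ-0^≈δ0 m))) ⟩
        Cₘ - (B + (f₁ * S₂ + (- (q * f₀)) * S₁)) + nᵐ * f₀ - δ0 m * f r
          ≈⟨ solve 9 (λ c B f₁ S₂ q f₀ S₁ N X → c :- (B :+ (f₁ :* S₂ :+ (:- (q :* f₀)) :* S₁)) :+ N :* f₀ :- X
                     := (N :* f₀ :- B) :+ (q :* S₁ :* f₀ :- S₂ :* f₁) :+ (:- X :+ c)) refl Cₘ B f₁ S₂ q f₀ S₁ nᵐ (δ0 m * f r) ⟩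
        (nᵐ * f₀ - B) + (q * S₁ * f₀ - S₂ * f₁) + (- (δ0 m * f r) + Cₘ)
          ≈⟨ +-cong (+-congʳ boundary-terms) (+-congʳ (-‿cong (*-comm _ _))) ⟩
        (nᵐ * q * dinv * f₀ - nᵐ * dinv * f₁) + (q * S₁ * f₀ - S₂ * f₁) + (- (f r * δ0 m) + Cₘ)
          ≈⟨ +-congʳ (solve 7 (λ N q d f₀ f₁ S₁ S₂ → (N :* q :* d :* f₀ :- N :* d :* f₁) :+ (q :* S₁ :* f₀ :- S₂ :* f₁)
                               := (N :* q :* d :+ q :* S₁) :* f₀ :+ ((:- (N :* d)) :- S₂) :* f₁) refl nᵐ q dinv f₀ f₁ S₁ S₂) ⟩
        (nᵐ * q * dinv + q * S₁) * f₀ + (- (nᵐ * dinv) - S₂) * f₁ + (- (f r * δ0 m) + Cₘ) ∎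
        where
        Cₘ = pow dinv (suc m) * eulerianForm q m (λ k → f (k ℤ.+ r))
        B = nᵐ * (dinv * (f M - q * f (ℤ.pred M)))
        f₀ = f M
        f₁ = f (M ℤ.+ ℤ.1ℤ)

mainTheorem17 : {c ℓ : Level} (R : CommutativeRing c ℓ) →
  let open CommutativeRing R
      open Horadam R
  in (a b p q qinv dinv : Carrier) →
     ¬ (p ≈ 0#) → q * qinv ≈ 1# → (1# - p + q) * dinv ≈ 1# →
     (m n : ℕ) (r : ℤ) →
     let ww = w a b p q qinv
         UU = U p q qinv
         P1 = fromℕ (n ^ m) * q * dinv
              + q * Σ< m (λ s' → let s = suc s' in
                  fromℕ (m C s) * fromℕ (n ^ (m ∸ s)) * pow dinv (suc s)
                  * Σ< (suc (suc s)) (λ c' → sgn c' * fromℕ (suc s C c') * pow q c'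
                      * Σ< (suc s) (λ j → eulerA s j * UU (+ j -ℤ + c' -ℤ 1ℤ))))
         P2 = - (fromℕ (n ^ m) * dinv)
              - Σ< m (λ s' → let s = suc s' in
                  fromℕ (m C s) * fromℕ (n ^ (m ∸ s)) * pow dinv (suc s)
                  * Σ< (suc (suc s)) (λ c' → sgn c' * fromℕ (suc s C c') * pow q c'
                      * Σ< (suc s) (λ j → eulerA s j * UU (+ j -ℤ + c'))))
         CC = - (ww r * δ0 m)
              + pow dinv (suc m)
                * Σ< (suc (suc m)) (λ c' → sgn c' * fromℕ (suc m C c') * pow q c'
                    * Σ< (suc m) (λ j → eulerA m j * ww (+ j -ℤ + c' +ℤ r)))
     in Σ< n (λ k → fromℕ (suc k ^ m) * ww (+ suc k +ℤ r))
        ≈ P1 * ww (+ n +ℤ r) + P2 * ww (+ n +ℤ r +ℤ 1ℤ) + CC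
mainTheorem17 R a b p q qinv dinv _ q*qinv≈1 d*dinv≈1 m n r =
  PowerWeightedSums.power-weighted-solution-sum R p q qinv dinv q*qinv≈1 d*dinv≈1 m (Horadam.w R a b p q qinv) n r
    (Recurrence.horadam-solution R p q qinv q*qinv≈1 a b)
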